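{- For every integer $k\geq 1$, there exists an infinite family of $2k$-regular simple graphs each of which is $(2k+1)$-ordered hamiltonian.
   Context: All graphs are finite and simple. A simple graph $G$ is $r$-ordered hamiltonian if, for every sequence $v_1, v_2, \ldots, v_r$ of $r$ distinct vertices of $G$, there exists a hamiltonian cycle of $G$ (a cycle containing every vertex of $G$) that contains $v_1, \ldots, v_r$ in this (cyclic) order. -}

module Defs where

open import Data.Nat using (ℕ; zero; suc; _∸_; _≤_; _<_)
open import Data.Fin using (Fin; toℕ)
open import Data.Bool using (Bool; true; false)
open import Data.List using (length; filterᵇ; allFin)
open import Data.Product using (Σ; ∃; _×_)
open import Function.Definitions using (Injective)
open import Relation.Binary.PropositionalEquality using (_≡_)

record SimpleGraph (n : ℕ) : Set where
  field
    adj   : Fin n → Fin n → Bool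
    sym   : ∀ u v → adj u v ≡ adj v u
    loopless : ∀ v → adj v v ≡ false
open SimpleGraph public

degree : ∀ {n} → SimpleGraph n → Fin n → ℕ
degree {n} G v = length (filterᵇ (adj G v) (allFin n))

Regular : ∀ {n} → ℕ → SimpleGraph n → Set
Regular {n} d G = ∀ (v : Fin n) → degree G v ≡ d

-- A hamiltonian cycle, given as a cyclic listing σ(0), σ(1), …, σ(n-1)
-- of all vertices (σ injective, hence a bijection of Fin n), with n ≥ 3,
-- consecutive vertices adjacent, and σ(n-1) adjacent to σ(0).
record HamCycle {n : ℕ} (G : SimpleGraph n) : Set where
  field
    σ        : Fin n → Fin n
    σ-inj    : Injective _≡_ _≡_ σ
    three≤n  : 3 ≤ n
    step     : ∀ (i j : Fin n) → toℕ j ≡ suc (toℕ i) → adj G (σ i) (σ j) ≡ true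
    close    : ∀ (i j : Fin n) → toℕ i ≡ n ∸ 1 → toℕ j ≡ 0 → adj G (σ i) (σ j) ≡ true
open HamCycle public

-- The hamiltonian cycle C contains v₁,…,v_r in this cyclic order:
-- some rotation of the listing of C meets them in order, i.e. there are
-- strictly increasing positions p₁ < … < p_r with σ(p_i) = v_i.
-- (Rotations: a listing with increasing positions exists iff the cyclic
-- order of v's along C is the given one; direction is fixed by the listing,
-- and we may choose the listing.)
ContainsInOrder : ∀ {n r} {G : SimpleGraph n} → HamCycle G → (Fin r → Fin n) → Set
ContainsInOrder {n} {r} C v =
  Σ (Fin r → Fin n) λ p →
    (∀ (i j : Fin r) → toℕ i < toℕ j → toℕ (p i) < toℕ (p j)) ×
    (∀ (i : Fin r) → σ C (p i) ≡ v i)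

OrderedHamiltonian : ∀ {n} → ℕ → SimpleGraph n → Set
OrderedHamiltonian {n} r G =
  ∀ (v : Fin r → Fin n) → Injective _≡_ _≡_ v →
    Σ (HamCycle G) λ C → ContainsInOrder C v

{-# OPTIONS --safe #-}

-- The graphs are blow-ups of an even cycle C_M: every cycle vertex c becomes an independent block
-- of k copies (c , 0), …, (c , k - 1), each adjacent to all copies of the two cycle neighbours of c.
-- Such a graph is 2k-regular on kM vertices, and M can be taken arbitrarily large.
--
-- By induction on k, any 2k + 1 distinct vertices β lie in their cyclic order on a hamiltonian
-- cycle. For k = 1 the graph is C_M and at most three vertices are prescribed, so one of the two
-- orientations of the cycle works. In the step to k + 1, since 3(k + 1) > 2k + 3 at most two blocks
-- are full in β, hence β has two cyclically consecutive entries a, b in different blocks such that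
-- every other block misses some label in β. Exchanging labels inside the blocks moves a and b to the
-- new layer k and the rest of β below it; by induction the rest lies in order on a hamiltonian cycle
-- of the k-fold blow-up, and the new layer is spliced into that cycle between the last and the first
-- entry of the rest, meeting a before b: as a lap around C_M next to one of the two ends, or, when
-- both ends lie in the blocks of a and b, along a perfect matching of C_M.

module Submission where

open import Defs using (SimpleGraph; HamCycle; ContainsInOrder; OrderedHamiltonian; Regular)

open import Data.Bool using (Bool; true; false; _∨_; if_then_else_; T)
import Data.Bool as Bool
open import Data.Empty using (⊥; ⊥-elim)
open import Data.Fin using (Fin; toℕ; fromℕ<)
import Data.Fin as Fin
open import Data.Fin.Properties using (toℕ-fromℕ<; toℕ-injective; toℕ<n)
open import Data.List using (List; []; _∷_; _++_; [_]; length; map; reverse; concatMap; upTo; tabulate; filterᵇ; allFin)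
open import Data.List.Properties
  using ( ++-assoc; ++-identityʳ; length-++; length-map; length-upTo; length-tabulate; unfold-reverse; reverse-++
        ; map-++; map-∘; map-cong; map-id; applyUpTo-∷ʳ )
open import Data.List.Membership.Propositional using (_∈_; _∉_; find; lose)
open import Data.List.Membership.Propositional.Properties
  using ( ∈-++⁺ˡ; ∈-++⁺ʳ; ∈-++⁻; ∈-∃++; ∈-map⁺; ∈-map⁻; ∈-upTo⁺; ∈-upTo⁻; ∈-concatMap⁺; ∈-concatMap⁻
        ; ∈-allFin; ∈-tabulate⁻ )
open import Data.List.Relation.Binary.Disjoint.Propositional using (Disjoint)
open import Data.List.Relation.Binary.Permutation.Propositional using (_↭_; ↭-sym; ↭-trans; ↭-reflexive; ↭-prep; ↭⇒↭ₛ)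
open import Data.List.Relation.Binary.Permutation.Propositional.Properties
  using (shift; shifts; ↭-length; ∈-resp-↭; ↭-reverse) renaming (++-comm to ↭-++-comm)
import Data.List.Relation.Binary.Permutation.Setoid.Properties as Permₛ
open import Data.List.Relation.Binary.Sublist.Propositional
  using (_⊆_; []; _∷_; _∷ʳ_; minimum; from∈; ⊆-refl; ⊆-trans; lookup)
import Data.List.Relation.Binary.Sublist.Propositional.Properties as Sub
open import Data.List.Relation.Binary.Sublist.Propositional.Properties using (All-resp-⊆)
open import Data.List.Relation.Unary.All using ([]; _∷_)
import Data.List.Relation.Unary.All as All
open import Data.List.Relation.Unary.All.Properties using (¬Any⇒All¬)
open import Data.List.Relation.Unary.Any using (Any; here; there; any?)
import Data.List.Relation.Unary.Any as Any
open import Data.List.Relation.Unary.Linked using (Linked; []; [-]; _∷_)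
import Data.List.Relation.Unary.Linked as Linked
import Data.List.Relation.Unary.Linked.Properties as Linked
open import Data.List.Relation.Unary.Unique.Propositional using (Unique; []; _∷_)
import Data.List.Relation.Unary.Unique.Propositional.Properties as Unique
open import Data.List.Relation.Unary.Unique.Propositional.Properties using (Unique[x∷xs]⇒x∉xs)
open import Data.Nat using (ℕ; zero; suc; _+_; _*_; _∸_; _%_; _/_; _≤_; _<_; z≤n; s≤s; s≤s⁻¹; _≟_; _<?_; parity)
open import Data.Nat.DivMod using (m%n<n; m<n*o⇒m/o<n; m≡m%n+[m/n]*n; [m+kn]%n≡m%n; [m+n]%n≡m%n; m<n⇒m%n≡m)
open import Data.Nat.Properties
  using ( ≤-refl; ≤-reflexive; ≤-trans; ≤-antisym; <-trans; ≤∧≢⇒<; <⇒≢; m≤n⇒m<n∨m≡n; n<1+n; 1+n≰n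
        ; m≤n⇒m≤1+n; m≤m+n; m≤n+m; m+1+n≢m; suc-injective; ≡ᵇ⇒≡; anyUpTo?
        ; +-comm; +-suc; +-assoc; +-identityʳ; +-monoˡ-<; +-cancelˡ-≡; +-cancelʳ-≤
        ; *-comm; *-monoˡ-≤; *-cancelʳ-≡ )
open import Data.Parity using (Parity; 0ℙ; 1ℙ; _⁻¹) renaming (_+_ to _ℙ+_)
open import Data.Parity.Properties using (p≢p⁻¹; p+p≡0ℙ; +-homo-+; suc-homo-⁻¹; ⁻¹-selfInverse; ⁻¹-involutive)
  renaming (_≟_ to _≟ₚ_)
open import Data.Product using (Σ; ∃; ∃₂; _×_; _,_; proj₁; proj₂)
open import Data.Product.Properties using (≡-dec)
open import Data.Sum using (_⊎_; inj₁; inj₂)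
import Data.Sum as Sum
open import Data.Unit using (tt)
open import Function using (id; _∘_)
open import Function.Definitions using (Injective)
open import Level using (0ℓ)
open import Relation.Binary.Core using (Rel)
open import Relation.Binary.Definitions using (Symmetric; DecidableEquality)
open import Relation.Binary.PropositionalEquality
  using (_≡_; _≢_; refl; sym; trans; cong; cong₂; subst; subst₂; setoid; module ≡-Reasoning)
open import Relation.Nullary using (¬_; ¬?; Dec; yes; no; does; _⊎-dec_; _×-dec_)
open import Relation.Nullary.Decidable using (decidable-stable; dec-true; dec-false)
open import Relation.Unary using (Pred)

module _ {A : Set} where

  ++-⊆-split : ∀ xs ys {zs : List A} → xs ++ ys ⊆ zs →
               ∃₂ λ zs₁ zs₂ → zs ≡ zs₁ ++ zs₂ × xs ⊆ zs₁ × ys ⊆ zs₂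
  ++-⊆-split [] ys p = [] , _ , refl , [] , p
  ++-⊆-split (x ∷ xs) ys (refl ∷ p) with ++-⊆-split xs ys p
  ... | zs₁ , zs₂ , refl , p₁ , p₂ = x ∷ zs₁ , zs₂ , refl , refl ∷ p₁ , p₂
  ++-⊆-split (x ∷ xs) ys (y ∷ʳ p) with ++-⊆-split (x ∷ xs) ys p
  ... | zs₁ , zs₂ , refl , p₁ , p₂ = y ∷ zs₁ , zs₂ , refl , y ∷ʳ p₁ , p₂

  ∷-⊆-split : ∀ {x xs} {zs : List A} → x ∷ xs ⊆ zs → ∃₂ λ P Q → zs ≡ P ++ x ∷ Q × xs ⊆ Q
  ∷-⊆-split (refl ∷ p) = [] , _ , refl , p
  ∷-⊆-split (y ∷ʳ p) with ∷-⊆-split p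
  ... | P , Q , refl , q = y ∷ P , Q , refl , q

  ∷ʳ-⊆-split : ∀ xs {x} {zs : List A} → xs ++ [ x ] ⊆ zs → ∃₂ λ P Q → zs ≡ P ++ x ∷ Q × xs ⊆ P
  ∷ʳ-⊆-split xs {x} p with ++-⊆-split xs [ x ] p
  ... | zs₁ , zs₂ , refl , p₁ , p₂ with ∷-⊆-split p₂
  ... | P , Q , refl , _ = zs₁ ++ P , Q , sym (++-assoc zs₁ P (x ∷ Q)) , Sub.++⁺ʳ P p₁

  Unique-⊆ : ∀ {xs ys : List A} → xs ⊆ ys → Unique ys → Unique xs
  Unique-⊆ [] _ = []
  Unique-⊆ (y ∷ʳ p) (_ ∷ u) = Unique-⊆ p u
  Unique-⊆ (refl ∷ p) (x≢ ∷ u) = All-resp-⊆ p x≢ ∷ Unique-⊆ p u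

  Unique-resp-↭ : ∀ {xs ys : List A} → xs ↭ ys → Unique xs → Unique ys
  Unique-resp-↭ p = Permₛ.Unique-resp-↭ (setoid A) (↭⇒↭ₛ p)

  Unique-++⇒Disjoint : ∀ xs {ys : List A} → Unique (xs ++ ys) → Disjoint xs ys
  Unique-++⇒Disjoint (x ∷ xs) (x≢ ∷ _) (here refl , z∈ys) = All.lookup x≢ (∈-++⁺ʳ xs z∈ys) refl
  Unique-++⇒Disjoint (x ∷ xs) (_ ∷ u) (there z∈xs , z∈ys) = Unique-++⇒Disjoint xs u (z∈xs , z∈ys)

  ↭-insertAfter : ∀ P (u : A) Y Q → P ++ u ∷ Y ++ Q ↭ Y ++ P ++ u ∷ Q
  ↭-insertAfter P u Y Q =
    ↭-trans (↭-reflexive (sym (++-assoc P [ u ] (Y ++ Q))))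
      (↭-trans (shifts (P ++ [ u ]) Y) (↭-reflexive (cong (Y ++_) (++-assoc P [ u ] Q))))

  Unique-length-≤ : ∀ {xs ys : List A} → Unique xs → (∀ {z} → z ∈ xs → z ∈ ys) → length xs ≤ length ys
  Unique-length-≤ [] _ = z≤n
  Unique-length-≤ {x ∷ xs} (x≢ ∷ u) xs⊆ys with ∈-∃++ (xs⊆ys (here refl))
  ... | P , Q , refl = subst (suc (length xs) ≤_) (sym (↭-length (shift x P Q))) (s≤s (Unique-length-≤ u xs⊆PQ))
    where
    xs⊆PQ : ∀ {z} → z ∈ xs → z ∈ P ++ Q
    xs⊆PQ z∈xs with ∈-resp-↭ (shift x P Q) (xs⊆ys (there z∈xs))
    ... | here z≡x = ⊥-elim (All.lookup x≢ z∈xs (sym z≡x))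
    ... | there z∈PQ = z∈PQ

module _ {A : Set} {R : Rel A 0ℓ} where
  open ≡-Reasoning

  Linked-++ : ∀ xs {a ys} → Linked R (xs ++ [ a ]) → Linked R (a ∷ ys) → Linked R (xs ++ a ∷ ys)
  Linked-++ [] _ l = l
  Linked-++ (x ∷ []) (r ∷ [-]) l = r ∷ l
  Linked-++ (x ∷ x′ ∷ xs) (r ∷ l₁) l₂ = r ∷ Linked-++ (x′ ∷ xs) l₁ l₂

  Linked-++⁻ : ∀ xs {a ys} → Linked R (xs ++ a ∷ ys) → Linked R (xs ++ [ a ]) × Linked R (a ∷ ys)
  Linked-++⁻ [] l = [-] , l
  Linked-++⁻ (x ∷ []) (r ∷ l) = r ∷ [-] , l
  Linked-++⁻ (x ∷ x′ ∷ xs) (r ∷ l) with Linked-++⁻ (x′ ∷ xs) l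
  ... | l₁ , l₂ = r ∷ l₁ , l₂

  Linked-reverse : Symmetric R → ∀ {xs} → Linked R xs → Linked R (reverse xs)
  Linked-reverse _ [] = []
  Linked-reverse _ [-] = [-]
  Linked-reverse R-sym {x ∷ y ∷ ys} (r ∷ l) =
    subst (Linked R) (sym reverse-x∷y∷ys)
      (Linked-++ (reverse ys) (subst (Linked R) (unfold-reverse y ys) (Linked-reverse R-sym l)) (R-sym r ∷ [-]))
    where
    reverse-x∷y∷ys : reverse (x ∷ y ∷ ys) ≡ reverse ys ++ y ∷ x ∷ []
    reverse-x∷y∷ys = begin
      reverse (x ∷ y ∷ ys)          ≡⟨ unfold-reverse x (y ∷ ys) ⟩
      reverse (y ∷ ys) ++ [ x ]     ≡⟨ cong (_++ [ x ]) (unfold-reverse y ys) ⟩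
      (reverse ys ++ [ y ]) ++ [ x ] ≡⟨ ++-assoc (reverse ys) [ y ] [ x ] ⟩
      reverse ys ++ y ∷ x ∷ []      ∎

  Cyclic : List A → Set
  Cyclic [] = ⊥
  Cyclic (w ∷ ws) = Linked R (w ∷ ws ++ [ w ])

  Linked-head : ∀ {a b ys} → (∀ {z} → R a z → R b z) → Linked R (a ∷ ys) → Linked R (b ∷ ys)
  Linked-head _ [-] = [-]
  Linked-head f (r ∷ l) = f r ∷ l

  Linked-last : ∀ xs {a b} → (∀ {z} → R z a → R z b) → Linked R (xs ++ [ a ]) → Linked R (xs ++ [ b ])
  Linked-last [] _ _ = [-]
  Linked-last (x ∷ []) f (r ∷ [-]) = f r ∷ [-]
  Linked-last (x ∷ x′ ∷ xs) f (r ∷ l) = r ∷ Linked-last (x′ ∷ xs) f l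

  private
    open-at : ∀ p P {u Q} → Cyclic (p ∷ P ++ u ∷ Q) → Linked R (p ∷ P ++ [ u ]) × Linked R (u ∷ Q ++ [ p ])
    open-at p P {u} {Q} c = Linked-++⁻ (p ∷ P) (subst (Linked R) (cong (p ∷_) (++-assoc P (u ∷ Q) [ p ])) c)

    close-at : ∀ p P {u Q} → Linked R (p ∷ P ++ [ u ]) → Linked R (u ∷ Q ++ [ p ]) → Cyclic (p ∷ P ++ u ∷ Q)
    close-at p P {u} {Q} l₁ l₂ =
      subst (Linked R) (cong (p ∷_) (sym (++-assoc P (u ∷ Q) [ p ]))) (Linked-++ (p ∷ P) l₁ l₂)

  Cyclic-rotate : ∀ P Q → Cyclic (P ++ Q) → Cyclic (Q ++ P)
  Cyclic-rotate [] Q c = subst Cyclic (sym (++-identityʳ Q)) c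
  Cyclic-rotate (p ∷ P) [] c = subst Cyclic (++-identityʳ (p ∷ P)) c
  Cyclic-rotate (p ∷ P) (q ∷ Q) c with open-at p P c
  ... | l₁ , l₂ = close-at q Q l₂ l₁

  Cyclic-insertAfter : ∀ P u Q L ℓ → (∀ {z} → R u z → R ℓ z) → Linked R (u ∷ L ++ [ ℓ ]) →
                       Cyclic (P ++ u ∷ Q) → Cyclic (P ++ u ∷ L ++ ℓ ∷ Q)
  Cyclic-insertAfter [] u Q L ℓ ℓ∼u detour c =
    subst (Linked R) (cong (u ∷_) (sym (++-assoc L (ℓ ∷ Q) [ u ]))) (Linked-++ (u ∷ L) detour (Linked-head ℓ∼u c))
  Cyclic-insertAfter (p ∷ P) u Q L ℓ ℓ∼u detour c with open-at p P c
  ... | l₁ , l₂ =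
    close-at p P l₁ (subst (Linked R) (cong (u ∷_) (sym (++-assoc L (ℓ ∷ Q) [ p ])))
                       (Linked-++ (u ∷ L) detour (Linked-head ℓ∼u l₂)))

  Cyclic-insertBefore : ∀ P u Q f L → (∀ {z} → R z u → R z f) → Linked R (f ∷ L ++ [ u ]) →
                        Cyclic (P ++ u ∷ Q) → Cyclic (P ++ f ∷ L ++ u ∷ Q)
  Cyclic-insertBefore [] u Q f L f∼u detour c =
    subst (Linked R) (cong (f ∷_) (sym (++-assoc L (u ∷ Q) [ f ])))
      (Linked-++ (f ∷ L) detour (Linked-last (u ∷ Q) f∼u c))
  Cyclic-insertBefore (p ∷ P) u Q f L f∼u detour c with open-at p P c
  ... | l₁ , l₂ = close-at p P (Linked-last (p ∷ P) f∼u l₁)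
                    (subst (Linked R) (cong (f ∷_) (sym (++-assoc L (u ∷ Q) [ p ]))) (Linked-++ (f ∷ L) detour l₂))

  Cyclic-reverse : Symmetric R → ∀ w ws → Cyclic (w ∷ ws) → Cyclic (w ∷ reverse ws)
  Cyclic-reverse R-sym w ws c = subst (Linked R) reverse-closed (Linked-reverse R-sym c)
    where
    reverse-closed : reverse (w ∷ ws ++ [ w ]) ≡ w ∷ reverse ws ++ [ w ]
    reverse-closed = begin
      reverse (w ∷ ws ++ [ w ])           ≡⟨ unfold-reverse w (ws ++ [ w ]) ⟩
      reverse (ws ++ [ w ]) ++ [ w ]      ≡⟨ cong (_++ [ w ]) (reverse-++ ws [ w ]) ⟩
      w ∷ reverse ws ++ [ w ]             ∎

  module _ (g : A → List A) (detour : ∀ {u v} → R u v → Linked R (u ∷ g u ++ [ v ])) where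

    private
      Linked-concatMap : ∀ xs z → Linked R (xs ++ [ z ]) → Linked R (concatMap (λ u → u ∷ g u) xs ++ [ z ])
      Linked-concatMap [] z l = l
      Linked-concatMap (x ∷ []) z (r ∷ [-]) =
        subst (λ t → Linked R (x ∷ t ++ [ z ])) (sym (++-identityʳ (g x))) (detour r)
      Linked-concatMap (x ∷ x′ ∷ xs) z (r ∷ l) =
        subst (Linked R) (cong (x ∷_) (sym (++-assoc (g x) (concatMap (λ u → u ∷ g u) (x′ ∷ xs)) [ z ])))
          (Linked-++ (x ∷ g x) (detour r) (Linked-concatMap (x′ ∷ xs) z l))

    Cyclic-concatMap : ∀ xs → Cyclic xs → Cyclic (concatMap (λ u → u ∷ g u) xs)
    Cyclic-concatMap (w ∷ ws) c = Linked-concatMap (w ∷ ws) w c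

module _ {A : Set} where

  ⊆-concatMap : (g : A → List A) → ∀ xs → xs ⊆ concatMap (λ u → u ∷ g u) xs
  ⊆-concatMap g [] = []
  ⊆-concatMap g (x ∷ xs) = refl ∷ Sub.++⁺ˡ (g x) (⊆-concatMap g xs)

  ∈-order : ∀ {x y} {xs : List A} → x ≢ y → x ∈ xs → y ∈ xs → x ∷ [ y ] ⊆ xs ⊎ y ∷ [ x ] ⊆ xs
  ∈-order x≢y x∈xs y∈xs with ∈-∃++ x∈xs
  ... | P , Q , refl with ∈-++⁻ P y∈xs
  ...   | inj₁ y∈P = inj₂ (Sub.++⁺ (from∈ y∈P) (refl ∷ minimum Q))
  ...   | inj₂ (here refl) = ⊥-elim (x≢y refl)
  ...   | inj₂ (there y∈Q) = inj₁ (Sub.++⁺ˡ P (refl ∷ from∈ y∈Q))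

  unsnoc : ∀ (x : A) xs → ∃₂ λ ys y → x ∷ xs ≡ ys ++ [ y ]
  unsnoc x [] = [] , x , refl
  unsnoc x (x′ ∷ xs) with unsnoc x′ xs
  ... | ys , y , eq = x ∷ ys , y , cong (x ∷_) eq

module _ {A B : Set} (f : A → List B) where

  Unique-concatMap : ∀ {xs} → Unique xs → (∀ {x} → x ∈ xs → Unique (f x)) →
                     (∀ {x y} → x ∈ xs → y ∈ xs → x ≢ y → Disjoint (f x) (f y)) → Unique (concatMap f xs)
  Unique-concatMap [] _ _ = []
  Unique-concatMap {x ∷ xs} (x≢ ∷ u) uf disj =
    Unique.++⁺ (uf (here refl)) (Unique-concatMap u (uf ∘ there) (λ x∈ y∈ → disj (there x∈) (there y∈)))
      λ (z∈fx , z∈rest) → let (y , y∈xs , z∈fy) = find (∈-concatMap⁻ f z∈rest)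
                          in disj (here refl) (there y∈xs) (All.lookup x≢ y∈xs) (z∈fx , z∈fy)

module _ {A B : Set} (_≟_ : DecidableEquality B) (f : A → B) where

  private
    Split : List A → Set
    Split xs = ∃₂ λ U V → ∃₂ λ a b → xs ≡ U ++ a ∷ b ∷ V × f a ≢ f b

    from-head : ∀ z zs {y} → y ∈ z ∷ zs → f z ≢ f y → Split (z ∷ zs)
    from-head z [] (here refl) fz≢fy = ⊥-elim (fz≢fy refl)
    from-head z (z′ ∷ zs) y∈ fz≢fy with f z ≟ f z′ | y∈
    ... | no fz≢fz′ | _ = [] , zs , z , z′ , refl , fz≢fz′
    ... | yes _ | here refl = ⊥-elim (fz≢fy refl)
    ... | yes fz≡fz′ | there y∈′ with from-head z′ zs y∈′ (λ e → fz≢fy (trans fz≡fz′ e))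
    ...   | U , V , a , b , eq , fa≢fb = z ∷ U , V , a , b , cong (z ∷_) eq , fa≢fb

  consecutive-≢ : ∀ xs {x y} → x ∈ xs → y ∈ xs → f x ≢ f y → Split xs
  consecutive-≢ (z ∷ zs) {x} {y} x∈ y∈ fx≢fy with f z ≟ f y
  ... | no fz≢fy = from-head z zs y∈ fz≢fy
  ... | yes fz≡fy = from-head z zs x∈ (λ e → fx≢fy (trans (sym e) fz≡fy))

record IsHamiltonian {A : Set} (R : Rel A 0ℓ) (P : Pred A 0ℓ) (W : List A) : Set where
  field
    cyclic   : Cyclic {R = R} W
    unique   : Unique W
    sound    : ∀ {v} → v ∈ W → P v
    complete : ∀ {v} → P v → v ∈ W

module _ {A : Set} {R : Rel A 0ℓ} {P : Pred A 0ℓ} where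

  IsHamiltonian-rotate : ∀ X Y → IsHamiltonian R P (X ++ Y) → IsHamiltonian R P (Y ++ X)
  IsHamiltonian-rotate X Y H = record
    { cyclic   = Cyclic-rotate X Y cyclic
    ; unique   = Unique-resp-↭ (↭-++-comm X Y) unique
    ; sound    = λ v∈ → sound (∈-resp-↭ (↭-++-comm Y X) v∈)
    ; complete = λ Pv → ∈-resp-↭ (↭-++-comm X Y) (complete Pv) }
    where open IsHamiltonian H

  IsHamiltonian-reverse : Symmetric R → ∀ w ws → IsHamiltonian R P (w ∷ ws) → IsHamiltonian R P (w ∷ reverse ws)
  IsHamiltonian-reverse R-sym w ws H = record
    { cyclic   = Cyclic-reverse R-sym w ws cyclic
    ; unique   = Unique-resp-↭ (↭-prep w (↭-sym (↭-reverse ws))) unique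
    ; sound    = λ v∈ → sound (∈-resp-↭ (↭-prep w (↭-reverse ws)) v∈)
    ; complete = λ Pv → ∈-resp-↭ (↭-prep w (↭-sym (↭-reverse ws))) (complete Pv) }
    where open IsHamiltonian H

  IsHamiltonian-map : (φ : A → A) → (∀ a → φ (φ a) ≡ a) → (∀ {a b} → R a b → R (φ a) (φ b)) →
                      (∀ {a} → P a → P (φ a)) → ∀ {W} → IsHamiltonian R P W → IsHamiltonian R P (map φ W)
  IsHamiltonian-map φ φ-involutive φ-R φ-P {w ∷ ws} H = record
    { cyclic   = subst (Linked R) (cong (φ w ∷_) (map-++ φ ws [ w ])) (Linked.map⁺ (Linked.map φ-R cyclic))
    ; unique   = Unique.map⁺ φ-injective unique
    ; sound    = λ v∈ → let (u , u∈ , v≡φu) = ∈-map⁻ φ v∈ in subst P (sym v≡φu) (φ-P (sound u∈))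
    ; complete = λ {v} Pv → subst (_∈ map φ (w ∷ ws)) (φ-involutive v) (∈-map⁺ φ (complete (φ-P Pv))) }
    where
    open IsHamiltonian H
    φ-injective : ∀ {a b} → φ a ≡ φ b → a ≡ b
    φ-injective {a} {b} e = trans (sym (φ-involutive a)) (trans (cong φ e) (φ-involutive b))

module _ {A : Set} (d : A) where

  nth : List A → ℕ → A
  nth [] _ = d
  nth (x ∷ xs) zero = x
  nth (x ∷ xs) (suc i) = nth xs i

  nth-∈ : ∀ {xs i} → i < length xs → nth xs i ∈ xs
  nth-∈ {x ∷ xs} {zero} _ = here refl
  nth-∈ {x ∷ xs} {suc i} (s≤s i<) = there (nth-∈ i<)

  nth-++ˡ : ∀ xs {ys i} → i < length xs → nth (xs ++ ys) i ≡ nth xs i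
  nth-++ˡ (x ∷ xs) {i = zero} _ = refl
  nth-++ˡ (x ∷ xs) {i = suc i} (s≤s i<) = nth-++ˡ xs i<

  nth-++-length : ∀ xs {y ys} → nth (xs ++ y ∷ ys) (length xs) ≡ y
  nth-++-length [] = refl
  nth-++-length (x ∷ xs) = nth-++-length xs

  nth-tabulate : ∀ {n} (f : Fin n → A) i → nth (tabulate f) (toℕ i) ≡ f i
  nth-tabulate f Fin.zero = refl
  nth-tabulate f (Fin.suc i) = nth-tabulate (f ∘ Fin.suc) i

  Linked-nth : ∀ {R : Rel A 0ℓ} {xs i} → Linked R xs → suc i < length xs → R (nth xs i) (nth xs (suc i))
  Linked-nth {i = zero} (r ∷ _) _ = r
  Linked-nth {i = suc i} (_ ∷ l) (s≤s i<) = Linked-nth l i<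
  Linked-nth [-] (s≤s ())

  Unique-nth-injective : ∀ {xs i j} → Unique xs → i < length xs → j < length xs → nth xs i ≡ nth xs j → i ≡ j
  Unique-nth-injective {x ∷ xs} {zero} {zero} _ _ _ _ = refl
  Unique-nth-injective {x ∷ xs} {zero} {suc j} (x≢ ∷ _) _ (s≤s j<) e = ⊥-elim (All.lookup x≢ (nth-∈ j<) e)
  Unique-nth-injective {x ∷ xs} {suc i} {zero} (x≢ ∷ _) (s≤s i<) _ e = ⊥-elim (All.lookup x≢ (nth-∈ i<) (sym e))
  Unique-nth-injective {x ∷ xs} {suc i} {suc j} (_ ∷ u) (s≤s i<) (s≤s j<) e =
    cong suc (Unique-nth-injective u i< j< e)

  ⊆-positions : ∀ {xs ys} → xs ⊆ ys → ∃ λ (p : ℕ → ℕ) →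
                (∀ {i} → i < length xs → p i < length ys × nth ys (p i) ≡ nth xs i) ×
                (∀ {i j} → i < j → j < length xs → p i < p j)
  ⊆-positions [] = id , (λ ()) , (λ _ ())
  ⊆-positions (y ∷ʳ xs⊆ys) with ⊆-positions xs⊆ys
  ... | p , hit , mono = suc ∘ p , (λ i< → s≤s (proj₁ (hit i<)) , proj₂ (hit i<)) , (λ i<j j< → s≤s (mono i<j j<))
  ⊆-positions (refl ∷ xs⊆ys) with ⊆-positions xs⊆ys
  ... | p , hit , mono = p′ , hit′ , mono′
    where
    p′ : ℕ → ℕ
    p′ zero = zero
    p′ (suc i) = suc (p i)
    hit′ : ∀ {i} → i < suc _ → p′ i < suc _ × _
    hit′ {zero} _ = s≤s z≤n , refl
    hit′ {suc i} (s≤s i<) = s≤s (proj₁ (hit i<)) , proj₂ (hit i<)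
    mono′ : ∀ {i j} → i < j → j < suc _ → p′ i < p′ j
    mono′ {zero} {suc j} _ _ = s≤s z≤n
    mono′ {suc i} {suc j} (s≤s i<j) (s≤s j<) = s≤s (mono i<j j<)

count : (ℕ → Bool) → ℕ → ℕ
count p zero = 0
count p (suc n) = (if p 0 then 1 else 0) + count (p ∘ suc) n

count-ext : ∀ n {p q} → (∀ {j} → j < n → p j ≡ q j) → count p n ≡ count q n
count-ext zero _ = refl
count-ext (suc n) p≗q = cong₂ _+_ (cong (λ b → if b then 1 else 0) (p≗q (s≤s z≤n))) (count-ext n (p≗q ∘ s≤s))

count-+ : ∀ m n p → count p (m + n) ≡ count p m + count (p ∘ (m +_)) n
count-+ zero n p = refl
count-+ (suc m) n p =
  trans (cong ((if p 0 then 1 else 0) +_) (count-+ m n (p ∘ suc))) (sym (+-assoc (if p 0 then 1 else 0) _ _))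

count-periodic : ∀ m k {p} → (∀ j → p (m + j) ≡ p j) → count p (k * m) ≡ k * count p m
count-periodic m zero _ = refl
count-periodic m (suc k) {p} periodic = begin
  count p (m + k * m)                  ≡⟨ count-+ m (k * m) p ⟩
  count p m + count (p ∘ (m +_)) (k * m) ≡⟨ cong (count p m +_) (count-ext (k * m) (λ {j} _ → periodic j)) ⟩
  count p m + count p (k * m)          ≡⟨ cong (count p m +_) (count-periodic m k periodic) ⟩
  count p m + k * count p m            ∎
  where open ≡-Reasoning

count-∨ : ∀ n p q → (∀ j → p j ≡ true → q j ≡ false) → count (λ j → p j ∨ q j) n ≡ count p n + count q n
count-∨ zero p q _ = refl
count-∨ (suc n) p q disjoint with p 0 in p0 | q 0 in q0
... | true | true with trans (sym (disjoint 0 p0)) q0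
...   | ()
count-∨ (suc n) p q disjoint | true | false = cong suc (count-∨ n (p ∘ suc) (q ∘ suc) (disjoint ∘ suc))
count-∨ (suc n) p q disjoint | false | true =
  trans (cong suc (count-∨ n (p ∘ suc) (q ∘ suc) (disjoint ∘ suc))) (sym (+-suc _ _))
count-∨ (suc n) p q disjoint | false | false = count-∨ n (p ∘ suc) (q ∘ suc) (disjoint ∘ suc)

count-≟ : ∀ {c n} → c < n → count (λ j → does (j ≟ c)) n ≡ 1
count-≟ {zero} {suc n} _ = cong suc (count-none n)
  where
  count-none : ∀ n → count (λ j → does (suc j ≟ 0)) n ≡ 0
  count-none zero = refl
  count-none (suc n) = count-none n
count-≟ {suc c} {suc n} (s≤s c<n) = count-≟ c<n

length-filterᵇ-tabulate : ∀ {A : Set} n (f : Fin n → A) (q : A → Bool) (p : ℕ → Bool) →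
                          (∀ i → q (f i) ≡ p (toℕ i)) → length (filterᵇ q (tabulate f)) ≡ count p n
length-filterᵇ-tabulate zero f q p _ = refl
length-filterᵇ-tabulate (suc n) f q p q≗p with q (f Fin.zero) | q≗p Fin.zero
... | true | q0≡p0 rewrite sym q0≡p0 = cong suc (length-filterᵇ-tabulate n (f ∘ Fin.suc) q (p ∘ suc) (q≗p ∘ Fin.suc))
... | false | q0≡p0 rewrite sym q0≡p0 = length-filterᵇ-tabulate n (f ∘ Fin.suc) q (p ∘ suc) (q≗p ∘ Fin.suc)

does-≡ : ∀ {P Q : Set} (p? : Dec P) (q? : Dec Q) → (P → Q) → (Q → P) → does p? ≡ does q?
does-≡ (yes p) q? P→Q _ = sym (dec-true q? (P→Q p))
does-≡ (no ¬p) q? _ Q→P = sym (dec-false q? (¬p ∘ Q→P))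

parity-suc : ∀ n → parity (suc n) ≡ parity n ⁻¹
parity-suc n = sym (⁻¹-selfInverse (suc-homo-⁻¹ n))

p≢q⇒p⁻¹≡q : ∀ {p q} → p ≢ q → p ⁻¹ ≡ q
p≢q⇒p⁻¹≡q {0ℙ} {0ℙ} p≢q = ⊥-elim (p≢q refl)
p≢q⇒p⁻¹≡q {0ℙ} {1ℙ} _ = refl
p≢q⇒p⁻¹≡q {1ℙ} {0ℙ} _ = refl
p≢q⇒p⁻¹≡q {1ℙ} {1ℙ} p≢q = ⊥-elim (p≢q refl)

module EvenCycle (h : ℕ) where

  -- Even, so that C_M has two perfect matchings, and at least 4, so that next c ≢ prev c.
  M : ℕ
  M = 4 + (h + h)

  next : ℕ → ℕ
  next c with suc c ≟ M
  ... | yes _ = 0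
  ... | no _ = suc c

  prev : ℕ → ℕ
  prev zero = 3 + (h + h)
  prev (suc c) = c

  Adjacent : Rel ℕ 0ℓ
  Adjacent c d = next c ≡ d ⊎ next d ≡ c

  Adjacent-sym : Symmetric Adjacent
  Adjacent-sym = Sum.swap

  adjacent? : ∀ c d → Dec (Adjacent c d)
  adjacent? c d = (next c ≟ d) ⊎-dec (next d ≟ c)

  0<M : 0 < M
  0<M = s≤s z≤n

  next-< : ∀ {c} → c < M → next c < M
  next-< {c} c<M with suc c ≟ M
  ... | yes _ = 0<M
  ... | no 1+c≢M = ≤∧≢⇒< c<M 1+c≢M

  next-suc : ∀ {c} → suc c < M → next c ≡ suc c
  next-suc {c} 1+c<M with suc c ≟ M
  ... | yes 1+c≡M = ⊥-elim (<⇒≢ 1+c<M 1+c≡M)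
  ... | no _ = refl

  next-last : next (3 + (h + h)) ≡ 0
  next-last with M ≟ M
  ... | yes _ = refl
  ... | no M≢M = ⊥-elim (M≢M refl)

  prev-< : ∀ {c} → c < M → prev c < M
  prev-< {zero} _ = n<1+n _
  prev-< {suc c} c<M = <-trans (n<1+n c) c<M

  next-prev : ∀ {c} → c < M → next (prev c) ≡ c
  next-prev {zero} _ = next-last
  next-prev {suc c} c<M = next-suc c<M

  prev-next : ∀ {c} → c < M → prev (next c) ≡ c
  prev-next {c} c<M with suc c ≟ M
  ... | yes 1+c≡M = suc-injective (sym 1+c≡M)
  ... | no _ = refl

  parity-next : ∀ {c} → c < M → parity (next c) ≡ parity c ⁻¹
  parity-next {c} c<M with suc c ≟ M
  ... | no _ = parity-suc c
  ... | yes 1+c≡M = begin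
    0ℙ                   ≡⟨ sym (p+p≡0ℙ (parity h)) ⟩
    parity h ℙ+ parity h ≡⟨ sym (+-homo-+ h h) ⟩
    parity M             ≡⟨ cong parity (sym 1+c≡M) ⟩
    parity (suc c)       ≡⟨ parity-suc c ⟩
    parity c ⁻¹          ∎
    where open ≡-Reasoning

  parity-prev : ∀ {c} → c < M → parity (prev c) ≡ parity c ⁻¹
  parity-prev {c} c<M = begin
    parity (prev c)          ≡⟨ sym (⁻¹-involutive _) ⟩
    parity (prev c) ⁻¹ ⁻¹    ≡⟨ cong _⁻¹ (sym (parity-next (prev-< c<M))) ⟩
    parity (next (prev c)) ⁻¹ ≡⟨ cong (λ d → parity d ⁻¹) (next-prev c<M) ⟩
    parity c ⁻¹              ∎
    where open ≡-Reasoning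

  next-≢ : ∀ {c} → c < M → next c ≢ c
  next-≢ {c} c<M e = p≢p⁻¹ (parity c) (trans (cong parity (sym e)) (parity-next c<M))

  next≢prev : ∀ {c} → c < M → next c ≢ prev c
  next≢prev {zero} _ e with trans (sym (next-suc {0} (s≤s (s≤s z≤n)))) e
  ... | ()
  next≢prev {suc c} c<M e with suc (suc c) ≟ M
  ... | yes 2+c≡M with trans (cong (2 +_) e) 2+c≡M
  ...   | ()
  next≢prev {suc c} c<M e | no _ = m+1+n≢m c (trans (+-comm c 2) e)

  Adjacent-next : ∀ c → Adjacent c (next c)
  Adjacent-next c = inj₁ refl

  Adjacent-prev : ∀ {c} → c < M → Adjacent c (prev c)
  Adjacent-prev c<M = inj₂ (next-prev c<M)

  Adjacent⇒≢ : ∀ {c d} → c < M → Adjacent c d → c ≢ d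
  Adjacent⇒≢ c<M (inj₁ e) refl = next-≢ c<M e
  Adjacent⇒≢ c<M (inj₂ e) refl = next-≢ c<M e

  blocks-cyclic : Cyclic {R = Adjacent} (upTo M)
  blocks-cyclic = subst (Linked Adjacent) closing
    (Linked-++ (upTo L) (subst (Linked Adjacent) (sym (applyUpTo-∷ʳ id L))
                           (Linked.applyUpTo⁺₁ id M (inj₁ ∘ next-suc)))
               (inj₁ next-last ∷ [-]))
    where
    L = 3 + (h + h)
    closing : upTo L ++ L ∷ [ 0 ] ≡ upTo M ++ [ 0 ]
    closing = trans (sym (++-assoc (upTo L) [ L ] [ 0 ])) (cong (_++ [ 0 ]) (applyUpTo-∷ʳ id L))

  IsLap : ℕ → List ℕ → Set
  IsLap c L = IsHamiltonian Adjacent (_< M) (c ∷ L)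

  lap : ∀ {c} → c < M → ∃ λ L → IsLap c L
  lap {c} c<M with ∈-∃++ (∈-upTo⁺ c<M)
  ... | A , B , upTo≡ = B ++ A , IsHamiltonian-rotate A (c ∷ B) (subst (IsHamiltonian Adjacent (_< M)) upTo≡ blocks)
    where
    blocks : IsHamiltonian Adjacent (_< M) (upTo M)
    blocks = record { cyclic = blocks-cyclic ; unique = Unique.upTo⁺ M ; sound = ∈-upTo⁻ ; complete = ∈-upTo⁺ }

  lap-∈ : ∀ {c L d} → IsLap c L → d < M → d ≢ c → d ∈ L
  lap-∈ H d<M d≢c with IsHamiltonian.complete H d<M
  ... | here d≡c = ⊥-elim (d≢c d≡c)
  ... | there d∈L = d∈L

  lap-ordered : ∀ {c x y} → c < M → x < M → y < M → x ≢ y → x ≢ c → y ≢ c →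
                ∃ λ L → IsLap c L × x ∷ [ y ] ⊆ L
  lap-ordered {c} c<M x<M y<M x≢y x≢c y≢c with lap c<M
  ... | L , H with ∈-order x≢y (lap-∈ H x<M x≢c) (lap-∈ H y<M y≢c)
  ...   | inj₁ xy⊆L = L , H , xy⊆L
  ...   | inj₂ yx⊆L = reverse L , IsHamiltonian-reverse Adjacent-sym c L H , Sub.reverse⁺ yx⊆L

  lap-before : ∀ {c x y} → c < M → x < M → y < M → x ≢ y → y ≢ c →
               ∃ λ L → IsLap c L × x ∷ [ y ] ⊆ c ∷ L
  lap-before {c} {x} c<M x<M y<M x≢y y≢c with x ≟ c
  ... | yes refl = let (L , H) = lap c<M in L , H , refl ∷ from∈ (lap-∈ H y<M y≢c)
  ... | no x≢c = let (L , H , xy⊆L) = lap-ordered c<M x<M y<M x≢y x≢c y≢c in L , H , c ∷ʳ xy⊆L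

  lap-after : ∀ {c x y} → c < M → x < M → y < M → x ≢ y → x ≢ c →
              ∃ λ L → IsLap c L × x ∷ [ y ] ⊆ L ++ [ c ]
  lap-after {c} {x} {y} c<M x<M y<M x≢y x≢c with y ≟ c
  ... | yes refl = let (L , H) = lap c<M in L , H , Sub.++⁺ (from∈ (lap-∈ H x<M x≢c)) (refl ∷ [])
  ... | no y≢c = let (L , H , xy⊆L) = lap-ordered c<M x<M y<M x≢y x≢c y≢c in L , H , Sub.++⁺ʳ [ c ] xy⊆L

  -- The perfect matching of C_M with edges {b , next b} for parity b ≡ π; base c is the end of
  -- the edge at c that has parity π.
  module Matching (π : Parity) where

    partner : ℕ → ℕ
    partner c with parity c ≟ₚ π
    ... | yes _ = next c
    ... | no _ = prev c

    base : ℕ → ℕ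
    base c with parity c ≟ₚ π
    ... | yes _ = c
    ... | no _ = prev c

    partner≡next : ∀ c → parity c ≡ π → partner c ≡ next c
    partner≡next c e with parity c ≟ₚ π
    ... | yes _ = refl
    ... | no ≢π = ⊥-elim (≢π e)

    partner≡prev : ∀ c → parity c ≢ π → partner c ≡ prev c
    partner≡prev c ≢π with parity c ≟ₚ π
    ... | yes e = ⊥-elim (≢π e)
    ... | no _ = refl

    private
      base≡self : ∀ c → parity c ≡ π → base c ≡ c
      base≡self c e with parity c ≟ₚ π
      ... | yes _ = refl
      ... | no ≢π = ⊥-elim (≢π e)

      base≡prev : ∀ c → parity c ≢ π → base c ≡ prev c
      base≡prev c ≢π with parity c ≟ₚ π
      ... | yes e = ⊥-elim (≢π e)
      ... | no _ = refl

      ⁻¹-≢ : ∀ {p} → p ≡ π → p ⁻¹ ≢ π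
      ⁻¹-≢ {p} p≡π p⁻¹≡π = p≢p⁻¹ p (trans p≡π (sym p⁻¹≡π))

      next-of-base : ∀ {b} → b < M → parity b ≡ π → parity (next b) ≢ π
      next-of-base b<M b≡π = subst (_≢ π) (sym (parity-next b<M)) (⁻¹-≢ b≡π)

      prev-of-nonbase : ∀ {c} → c < M → parity c ≢ π → parity (prev c) ≡ π
      prev-of-nonbase c<M c≢π = trans (parity-prev c<M) (p≢q⇒p⁻¹≡q c≢π)

    partner-< : ∀ {c} → c < M → partner c < M
    partner-< {c} c<M with parity c ≟ₚ π
    ... | yes _ = next-< c<M
    ... | no _ = prev-< c<M

    Adjacent-partner : ∀ {c} → c < M → Adjacent c (partner c)
    Adjacent-partner {c} c<M with parity c ≟ₚ π
    ... | yes _ = Adjacent-next c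
    ... | no _ = Adjacent-prev c<M

    partner-involutive : ∀ {c} → c < M → partner (partner c) ≡ c
    partner-involutive {c} c<M with parity c ≟ₚ π
    ... | yes c≡π = trans (partner≡prev (next c) (next-of-base c<M c≡π)) (prev-next c<M)
    ... | no c≢π = trans (partner≡next (prev c) (prev-of-nonbase c<M c≢π)) (next-prev c<M)

    base-< : ∀ {c} → c < M → base c < M
    base-< {c} c<M with parity c ≟ₚ π
    ... | yes _ = c<M
    ... | no _ = prev-< c<M

    base-parity : ∀ {c} → c < M → parity (base c) ≡ π
    base-parity {c} c<M with parity c ≟ₚ π
    ... | yes c≡π = c≡π
    ... | no c≢π = prev-of-nonbase c<M c≢π

    base-cover : ∀ {c} → c < M → c ≡ base c ⊎ c ≡ next (base c)
    base-cover {c} c<M with parity c ≟ₚ π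
    ... | yes _ = inj₁ refl
    ... | no _ = inj₂ (sym (next-prev c<M))

    base-of-pair : ∀ {b d} → b < M → parity b ≡ π → d ≡ b ⊎ d ≡ next b → base d ≡ b
    base-of-pair {b} _ b≡π (inj₁ refl) = base≡self b b≡π
    base-of-pair {b} b<M b≡π (inj₂ refl) = trans (base≡prev (next b) (next-of-base b<M b≡π)) (prev-next b<M)

    base-partner : ∀ {c} → c < M → base (partner c) ≡ base c
    base-partner {c} c<M with parity c ≟ₚ π
    ... | yes c≡π = base-of-pair c<M c≡π (inj₂ refl)
    ... | no c≢π = base≡self (prev c) (prev-of-nonbase c<M c≢π)

    same-base : ∀ {c w} → c < M → w < M → base c ≡ base w → c ≡ w ⊎ c ≡ partner w
    same-base {c} {w} c<M w<M bc≡bw with base-cover c<M | base-cover w<M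
    ... | inj₁ c≡b | inj₁ w≡b = inj₁ (trans c≡b (trans bc≡bw (sym w≡b)))
    ... | inj₂ c≡nb | inj₂ w≡nb = inj₁ (trans c≡nb (trans (cong next bc≡bw) (sym w≡nb)))
    ... | inj₁ c≡b | inj₂ w≡nb = inj₂ (begin
      c                   ≡⟨ trans c≡b bc≡bw ⟩
      base w              ≡⟨ sym (prev-next (base-< w<M)) ⟩
      prev (next (base w)) ≡⟨ cong prev (sym w≡nb) ⟩
      prev w              ≡⟨ sym (partner≡prev w (subst (_≢ π) (cong parity (sym w≡nb))
                                                   (next-of-base (base-< w<M) (base-parity w<M)))) ⟩
      partner w           ∎)
      where open ≡-Reasoning
    ... | inj₂ c≡nb | inj₁ w≡b = inj₂ (begin
      c                   ≡⟨ trans c≡nb (cong next bc≡bw) ⟩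
      next (base w)       ≡⟨ cong next (sym w≡b) ⟩
      next w              ≡⟨ sym (partner≡next w (subst (λ d → parity d ≡ π) (sym w≡b) (base-parity w<M))) ⟩
      partner w           ∎)
      where open ≡-Reasoning

  matching-avoiding : ∀ {x y} → x < M → x ≢ y → ∃ λ π → Matching.partner π x ≢ y
  matching-avoiding {x} {y} x<M x≢y with next x ≟ y
  ... | no nx≢y = parity x , subst (_≢ y) (sym (partner≡next x refl)) nx≢y
    where open Matching (parity x)
  ... | yes nx≡y = parity x ⁻¹ , subst (_≢ y) (sym (partner≡prev x (p≢p⁻¹ (parity x))))
                                  (λ px≡y → next≢prev x<M (trans nx≡y (sym px≡y)))
    where open Matching (parity x ⁻¹)

module Blowup (h : ℕ) where
  open EvenCycle h public
  open import Data.List.Membership.DecPropositional (≡-dec _≟_ _≟_) using (_∈?_)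

  -- (c , i) is copy i of the cycle vertex c; the k-fold blow-up has the vertices Valid k.
  Vertex : Set
  Vertex = ℕ × ℕ

  _∼_ : Rel Vertex 0ℓ
  u ∼ v = Adjacent (proj₁ u) (proj₁ v)

  Valid : ℕ → Pred Vertex 0ℓ
  Valid k (c , i) = c < M × i < k

  IsHamCycle : ℕ → List Vertex → Set
  IsHamCycle k = IsHamiltonian _∼_ (Valid k)

  HamThrough : ℕ → List Vertex → Set
  HamThrough k β = ∃ λ W → IsHamCycle k W × β ⊆ W

  HamThrough-⊆ : ∀ {k β γ} → β ⊆ γ → HamThrough k γ → HamThrough k β
  HamThrough-⊆ β⊆γ (W , H , γ⊆W) = W , H , ⊆-trans β⊆γ γ⊆W

  HamThrough-rotate : ∀ {k} X Y → HamThrough k (X ++ Y) → HamThrough k (Y ++ X)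
  HamThrough-rotate X Y (W , H , XY⊆W) with ++-⊆-split X Y XY⊆W
  ... | W₁ , W₂ , refl , X⊆W₁ , Y⊆W₂ = W₂ ++ W₁ , IsHamiltonian-rotate W₁ W₂ H , Sub.++⁺ Y⊆W₂ X⊆W₁

  layer : ℕ → List ℕ → List Vertex
  layer i = map (_, i)

  ∈-layer⁻ : ∀ {i cs v} → v ∈ layer i cs → proj₁ v ∈ cs × proj₂ v ≡ i
  ∈-layer⁻ {i} v∈ with ∈-map⁻ (_, i) v∈
  ... | c , c∈ , refl = c∈ , refl

  ∈-layer⁺ : ∀ {i cs c} → c ∈ cs → (c , i) ∈ layer i cs
  ∈-layer⁺ {i} = ∈-map⁺ (_, i)

  Unique-layer : ∀ {i cs} → Unique cs → Unique (layer i cs)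
  Unique-layer = Unique.map⁺ λ { refl → refl }

  Cyclic-layer : ∀ {i c cs} → Cyclic {R = Adjacent} (c ∷ cs) → Cyclic {R = _∼_} (layer i (c ∷ cs))
  Cyclic-layer {i} {c} {cs} cyc = subst (Linked _∼_) (cong ((c , i) ∷_) (map-++ (_, i) cs [ c ])) (Linked.map⁺ cyc)

  lap-isHamCycle₁ : ∀ {c L} → IsLap c L → IsHamCycle 1 (layer 0 (c ∷ L))
  lap-isHamCycle₁ {c} {L} H = record
    { cyclic   = Cyclic-layer cyclic
    ; unique   = Unique-layer unique
    ; sound    = λ v∈ → let (c∈ , i≡0) = ∈-layer⁻ v∈ in sound c∈ , subst (_< 1) (sym i≡0) (s≤s z≤n)
    ; complete = λ { {d , 0} (d<M , _) → ∈-layer⁺ (complete d<M) ; {d , suc _} (_ , s≤s ()) } }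
    where open IsHamiltonian H

  record Admissible (k : ℕ) (β : List Vertex) : Set where
    field
      unique : Unique β
      valid  : ∀ {v} → v ∈ β → Valid k v
      short  : length β ≤ suc (k + k)

  private
    head-≢ : ∀ {A : Set} {x y : A} {xs} → Unique (x ∷ xs) → y ∈ xs → x ≢ y
    head-≢ (x≢ ∷ _) = All.lookup x≢

    block-≢ : ∀ {c d i j : ℕ} → (c , i) ≢ (d , j) → i ≡ j → c ≢ d
    block-≢ ne refl refl = ne refl

  hamThrough₁ : ∀ β → Admissible 1 β → HamThrough 1 β
  hamThrough₁ [] _ = let (L , H) = lap 0<M in _ , lap-isHamCycle₁ H , minimum _
  hamThrough₁ ((c , 0) ∷ []) adm =
    let (L , H) = lap (proj₁ (Admissible.valid adm (here refl))) in _ , lap-isHamCycle₁ H , refl ∷ minimum _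
  hamThrough₁ ((c , 0) ∷ (d , 0) ∷ []) adm =
    let (L , H) = lap c<M
    in _ , lap-isHamCycle₁ H , refl ∷ from∈ (∈-layer⁺ (lap-∈ H d<M (block-≢ (head-≢ unique (here refl)) refl ∘ sym)))
    where
    open Admissible adm
    c<M = proj₁ (valid (here refl))
    d<M = proj₁ (valid (there (here refl)))
  hamThrough₁ ((c , 0) ∷ (d , 0) ∷ (e , 0) ∷ []) adm =
    let (L , H , de⊆L) = lap-ordered c<M d<M e<M (block-≢ (head-≢ (Unique.drop⁺ 1 unique) (here refl)) refl)
                           (block-≢ (head-≢ unique (here refl)) refl ∘ sym)
                           (block-≢ (head-≢ unique (there (here refl))) refl ∘ sym)
    in _ , lap-isHamCycle₁ H , refl ∷ Sub.map⁺ (_, 0) de⊆L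
    where
    open Admissible adm
    c<M = proj₁ (valid (here refl))
    d<M = proj₁ (valid (there (here refl)))
    e<M = proj₁ (valid (there (there (here refl))))
  hamThrough₁ ((c , suc _) ∷ _) adm with Admissible.valid adm (here refl)
  ... | _ , s≤s ()
  hamThrough₁ ((c , 0) ∷ (d , suc _) ∷ _) adm with Admissible.valid adm (there (here refl))
  ... | _ , s≤s ()
  hamThrough₁ ((c , 0) ∷ (d , 0) ∷ (e , suc _) ∷ _) adm with Admissible.valid adm (there (there (here refl)))
  ... | _ , s≤s ()
  hamThrough₁ (_ ∷ _ ∷ _ ∷ _ ∷ _) adm with Admissible.short adm
  ... | s≤s (s≤s (s≤s ()))

  Layer : ℕ → Pred Vertex 0ℓ
  Layer k (c , i) = c < M × i ≡ k

  record Extension (W : List Vertex) (New : Pred Vertex 0ℓ) (N : List Vertex) : Set where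
    field
      cyclic : Cyclic {R = _∼_} N
      unique : Unique N
      sound  : ∀ {z} → z ∈ N → z ∈ W ⊎ New z
      keeps  : ∀ {z} → z ∈ W → z ∈ N
      adds   : ∀ {z} → New z → z ∈ N

  Extension-↭ : ∀ {W Y N} → N ↭ Y ++ W → Cyclic {R = _∼_} N → Unique W → Unique Y → Disjoint Y W →
                Extension W (_∈ Y) N
  Extension-↭ {Y = Y} N↭YW cyc uW uY disj = record
    { cyclic = cyc
    ; unique = Unique-resp-↭ (↭-sym N↭YW) (Unique.++⁺ uY uW disj)
    ; sound  = λ z∈ → Sum.swap (∈-++⁻ Y (∈-resp-↭ N↭YW z∈))
    ; keeps  = λ z∈ → ∈-resp-↭ (↭-sym N↭YW) (∈-++⁺ʳ Y z∈)
    ; adds   = λ z∈ → ∈-resp-↭ (↭-sym N↭YW) (∈-++⁺ˡ z∈) }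

  Extension-trans : ∀ {W E₁ N₁ E₂ N₂} → Extension W E₁ N₁ → Extension N₁ E₂ N₂ → Extension W (λ z → E₁ z ⊎ E₂ z) N₂
  Extension-trans X₁ X₂ = record
    { cyclic = X₂.cyclic
    ; unique = X₂.unique
    ; sound  = λ z∈ → Sum.[ Sum.map₂ inj₁ ∘ X₁.sound , inj₂ ∘ inj₂ ] (X₂.sound z∈)
    ; keeps  = X₂.keeps ∘ X₁.keeps
    ; adds   = Sum.[ X₂.keeps ∘ X₁.adds , X₂.adds ] }
    where
    module X₁ = Extension X₁
    module X₂ = Extension X₂

  Extension⇒IsHamCycle : ∀ {k W New N} → IsHamCycle k W → Extension W New N →
                         (∀ {z} → New z → Layer k z) → (∀ {z} → Layer k z → New z) → IsHamCycle (suc k) N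
  Extension⇒IsHamCycle {k} H X new⇒layer layer⇒new = record
    { cyclic   = cyclic
    ; unique   = unique
    ; sound    = sound′
    ; complete = complete′ }
    where
    open Extension X
    sound′ : ∀ {z} → z ∈ _ → Valid (suc k) z
    sound′ z∈ with sound z∈
    ... | inj₁ z∈W = let (c<M , i<k) = IsHamiltonian.sound H z∈W in c<M , m≤n⇒m≤1+n i<k
    ... | inj₂ new = let (c<M , i≡k) = new⇒layer new in c<M , s≤s (≤-reflexive i≡k)
    complete′ : ∀ {z} → Valid (suc k) z → z ∈ _
    complete′ (c<M , s≤s i≤k) with m≤n⇒m<n∨m≡n i≤k
    ... | inj₁ i<k = keeps (IsHamiltonian.complete H (c<M , i<k))
    ... | inj₂ i≡k = adds (layer⇒new (c<M , i≡k))

  fresh-disjoint : ∀ {k W Y} → IsHamCycle k W → (∀ {z} → z ∈ Y → proj₂ z ≡ k) → Disjoint Y W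
  fresh-disjoint H fresh (z∈Y , z∈W) = <⇒≢ (proj₂ (IsHamiltonian.sound H z∈W)) (fresh z∈Y)

  Extension-concatMap : ∀ {W} (g : Vertex → List Vertex) → (∀ {u v} → u ∼ v → Linked _∼_ (u ∷ g u ++ [ v ])) →
                        Cyclic {R = _∼_} W → Unique W → (∀ {u} → u ∈ W → Unique (u ∷ g u)) →
                        (∀ {u v} → u ∈ W → v ∈ W → u ≢ v → Disjoint (u ∷ g u) (v ∷ g v)) →
                        Extension W (λ z → Any ((z ∈_) ∘ g) W) (concatMap (λ u → u ∷ g u) W)
  Extension-concatMap {W} g detour cyc uW ug disj = record
    { cyclic = Cyclic-concatMap g detour W cyc
    ; unique = Unique-concatMap (λ u → u ∷ g u) uW ug disj
    ; sound  = sound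
    ; keeps  = lookup (⊆-concatMap g W)
    ; adds   = ∈-concatMap⁺ (λ u → u ∷ g u) ∘ Any.map there }
    where
    sound : ∀ {z} → z ∈ concatMap (λ u → u ∷ g u) W → z ∈ W ⊎ Any ((z ∈_) ∘ g) W
    sound z∈ with find (∈-concatMap⁻ (λ u → u ∷ g u) z∈)
    ... | u , u∈W , here refl = inj₁ u∈W
    ... | u , u∈W , there z∈gu = inj₂ (lose u∈W z∈gu)

  module _ {k : ℕ} {Z : List ℕ} (H : IsHamiltonian Adjacent (_< M) Z) where

    layer-sound : ∀ {z} → z ∈ layer k Z → Layer k z
    layer-sound z∈ = let (c∈ , i≡k) = ∈-layer⁻ z∈ in IsHamiltonian.sound H c∈ , i≡k

    layer-complete : ∀ {z} → Layer k z → z ∈ layer k Z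
    layer-complete {c , .k} (c<M , refl) = ∈-layer⁺ (IsHamiltonian.complete H c<M)

  insert-lap-before : ∀ {k W} P u Q {L} → IsHamCycle k W → W ≡ P ++ u ∷ Q → IsLap (proj₁ u) L →
                      IsHamCycle (suc k) (P ++ layer k (proj₁ u ∷ L) ++ u ∷ Q)
  insert-lap-before {k} P u Q {L} H refl lapH =
    Extension⇒IsHamCycle H (Extension-↭ (shifts P (layer k (proj₁ u ∷ L))) cyc (IsHamiltonian.unique H)
                              (Unique-layer (IsHamiltonian.unique lapH)) (fresh-disjoint H (proj₂ ∘ ∈-layer⁻)))
      (layer-sound lapH) (layer-complete lapH)
    where
    cyc : Cyclic {R = _∼_} (P ++ layer k (proj₁ u ∷ L) ++ u ∷ Q)
    cyc = Cyclic-insertBefore P u Q (proj₁ u , k) (layer k L) id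
            (Linked-last ((proj₁ u , k) ∷ layer k L) id (Cyclic-layer (IsHamiltonian.cyclic lapH)))
            (IsHamiltonian.cyclic H)

  insert-lap-after : ∀ {k W} P u Q {L} → IsHamCycle k W → W ≡ P ++ u ∷ Q → IsLap (proj₁ u) L →
                     IsHamCycle (suc k) (P ++ u ∷ layer k (L ++ [ proj₁ u ]) ++ Q)
  insert-lap-after {k} P u Q {L} H refl lapH =
    Extension⇒IsHamCycle H (Extension-↭ (↭-insertAfter P u Lₖ Q) cyc (IsHamiltonian.unique H)
                              (Unique-layer (IsHamiltonian.unique lapH′)) (fresh-disjoint H (proj₂ ∘ ∈-layer⁻)))
      (layer-sound lapH′) (layer-complete lapH′)
    where
    c = proj₁ u
    Lₖ = layer k (L ++ [ c ])
    lapH′ : IsHamiltonian Adjacent (_< M) (L ++ [ c ])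
    lapH′ = IsHamiltonian-rotate [ c ] L lapH
    cyc : Cyclic {R = _∼_} (P ++ u ∷ Lₖ ++ Q)
    cyc = subst (λ t → Cyclic (P ++ u ∷ t))
            (sym (trans (cong (_++ Q) (map-++ (_, k) L [ c ])) (++-assoc (layer k L) [ (c , k) ] Q)))
            (Cyclic-insertAfter P u Q (layer k L) (c , k) id
              (Linked-head id (Cyclic-layer (IsHamiltonian.cyclic lapH))) (IsHamiltonian.cyclic H))

  module _ {k : ℕ} {W : List Vertex} (H : IsHamCycle k W) {x y : ℕ} (x<M : x < M) (y<M : y < M) (x≢y : x ≢ y) where

    private
      block< : ∀ {P u Q} → W ≡ P ++ u ∷ Q → proj₁ u < M
      block< {P} refl = proj₁ (IsHamiltonian.sound H (∈-++⁺ʳ P (here refl)))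

    thread-before : ∀ c₁ C₁ → c₁ ∷ C₁ ⊆ W → y ≢ proj₁ c₁ → HamThrough (suc k) ((c₁ ∷ C₁) ++ (x , k) ∷ (y , k) ∷ [])
    thread-before c₁ C₁ C⊆W y≢c with ∷-⊆-split C⊆W
    ... | P , Q , W≡ , C₁⊆Q with lap-before (block< W≡) x<M y<M x≢y y≢c
    ...   | L , lapH , xy⊆ =
      HamThrough-rotate ((x , k) ∷ (y , k) ∷ []) (c₁ ∷ C₁)
        (_ , insert-lap-before P c₁ Q H W≡ lapH , Sub.++⁺ˡ P (Sub.++⁺ (Sub.map⁺ (_, k) xy⊆) (refl ∷ C₁⊆Q)))

    thread-after : ∀ C₀ cL → C₀ ++ [ cL ] ⊆ W → x ≢ proj₁ cL →
                   HamThrough (suc k) ((C₀ ++ [ cL ]) ++ (x , k) ∷ (y , k) ∷ [])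
    thread-after C₀ cL C⊆W x≢c with ∷ʳ-⊆-split C₀ C⊆W
    ... | P , Q , W≡ , C₀⊆P with lap-after (block< W≡) x<M y<M x≢y x≢c
    ...   | L , lapH , xy⊆ =
      subst (HamThrough (suc k)) (sym (++-assoc C₀ [ cL ] ((x , k) ∷ (y , k) ∷ [])))
        (_ , insert-lap-after P cL Q H W≡ lapH , Sub.++⁺ C₀⊆P (refl ∷ Sub.++⁺ʳ Q (Sub.map⁺ (_, k) xy⊆)))

    -- When C starts in block y and ends in block x, no lap fits at its ends. Choose a matching in
    -- which x and y are not partners, insert (partner x , k) (x , k) after the end of C and
    -- (y , k) (partner y , k) before its start, and every other matched pair {b , next b} as the
    -- detour (b , 0) → (next b , k) → (b , k).
    module ThroughMatching (1≤k : 1 ≤ k) where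

      π : Parity
      π = proj₁ (matching-avoiding x<M x≢y)

      open Matching π

      px≢y : partner x ≢ y
      px≢y = proj₂ (matching-avoiding x<M x≢y)

      X PX Y PY : Vertex
      X = x , k
      PX = partner x , k
      Y = y , k
      PY = partner y , k

      Special : ℕ → Set
      Special d = base d ≡ base x ⊎ base d ≡ base y

      Free : ℕ → Set
      Free b = b < M × parity b ≡ π × b ≢ base x × b ≢ base y

      free? : ∀ b → Dec (Free b)
      free? b = (b <? M) ×-dec (parity b ≟ₚ π) ×-dec ¬? (b ≟ base x) ×-dec ¬? (b ≟ base y)

      pairs : Vertex → List Vertex
      pairs (b , zero) with free? b
      ... | yes _ = (next b , k) ∷ (b , k) ∷ []
      ... | no _ = []
      pairs (b , suc _) = []

      PairOf : Vertex → Vertex → Set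
      PairOf u z = ∃ λ b → u ≡ (b , 0) × Free b × proj₂ z ≡ k × (proj₁ z ≡ b ⊎ proj₁ z ≡ next b)

      pairs-sound : ∀ u {z} → z ∈ pairs u → PairOf u z
      pairs-sound (b , zero) z∈ with free? b
      pairs-sound (b , zero) (here refl) | yes free = b , refl , free , refl , inj₂ refl
      pairs-sound (b , zero) (there (here refl)) | yes free = b , refl , free , refl , inj₁ refl
      pairs-sound (b , zero) () | no _
      pairs-sound (b , suc _) ()

      pairs-complete : ∀ {b c} → Free b → c ≡ b ⊎ c ≡ next b → (c , k) ∈ pairs (b , 0)
      pairs-complete {b} free c∈ with free? b
      ... | no ¬free = ⊥-elim (¬free free)
      pairs-complete {b} free (inj₁ refl) | yes _ = there (here refl)
      pairs-complete {b} free (inj₂ refl) | yes _ = here refl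

      PairOf-base : ∀ {u z} → (pz : PairOf u z) → base (proj₁ z) ≡ proj₁ pz
      PairOf-base (b , _ , (b<M , b≡π , _) , _ , z∈) = base-of-pair b<M b≡π z∈

      PairOf-¬special : ∀ {u z} → PairOf u z → ¬ Special (proj₁ z)
      PairOf-¬special pz@(b , _ , (_ , _ , b≢bx , b≢by) , _) special with special
      ... | inj₁ bz≡bx = b≢bx (trans (sym (PairOf-base pz)) bz≡bx)
      ... | inj₂ bz≡by = b≢by (trans (sym (PairOf-base pz)) bz≡by)

      PairOf-unique : ∀ {u v z} → PairOf u z → PairOf v z → u ≡ v
      PairOf-unique pu@(_ , refl , _) pv@(_ , refl , _) = cong (_, 0) (trans (sym (PairOf-base pu)) (PairOf-base pv))

      detour : ∀ {u v} → u ∼ v → Linked _∼_ (u ∷ pairs u ++ [ v ])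
      detour {b , zero} u∼v with free? b
      ... | yes _ = Adjacent-next b ∷ Adjacent-sym (Adjacent-next b) ∷ u∼v ∷ [-]
      ... | no _ = u∼v ∷ [-]
      detour {b , suc _} u∼v = u∼v ∷ [-]

      Unique-pairs : ∀ u → Unique (u ∷ pairs u)
      Unique-pairs (b , zero) with free? b
      ... | yes (b<M , _) = (0≢k ∘ cong proj₂ ∷ 0≢k ∘ cong proj₂ ∷ []) ∷ (next-≢ b<M ∘ cong proj₁ ∷ []) ∷ [] ∷ []
        where
        0≢k : 0 ≢ k
        0≢k = <⇒≢ 1≤k
      ... | no _ = [] ∷ []
      Unique-pairs (b , suc _) = [] ∷ []

      private
        x≢px : x ≢ partner x
        x≢px = Adjacent⇒≢ x<M (Adjacent-partner x<M)

        y≢py : y ≢ partner y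
        y≢py = Adjacent⇒≢ y<M (Adjacent-partner y<M)

        py≢x : partner y ≢ x
        py≢x py≡x = px≢y (trans (cong partner (sym py≡x)) (partner-involutive y<M))

        py≢px : partner y ≢ partner x
        py≢px py≡px =
          x≢y (trans (sym (partner-involutive x<M)) (trans (cong partner (sym py≡px)) (partner-involutive y<M)))

        new-label : ∀ {z} → z ∈ PX ∷ X ∷ [] ⊎ z ∈ Y ∷ PY ∷ [] → proj₂ z ≡ k
        new-label (inj₁ (here refl)) = refl
        new-label (inj₁ (there (here refl))) = refl
        new-label (inj₂ (here refl)) = refl
        new-label (inj₂ (there (here refl))) = refl

        new-special : ∀ {z} → z ∈ PX ∷ X ∷ [] ⊎ z ∈ Y ∷ PY ∷ [] → Special (proj₁ z)
        new-special (inj₁ (here refl)) = inj₁ (base-partner x<M)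
        new-special (inj₁ (there (here refl))) = inj₁ refl
        new-special (inj₂ (here refl)) = inj₂ refl
        new-special (inj₂ (there (here refl))) = inj₂ (base-partner y<M)

        new-disjoint : Disjoint (Y ∷ PY ∷ []) (PX ∷ X ∷ [])
        new-disjoint (here refl , here e) = px≢y (sym (cong proj₁ e))
        new-disjoint (here refl , there (here e)) = x≢y (sym (cong proj₁ e))
        new-disjoint (there (here refl) , here e) = py≢px (cong proj₁ e)
        new-disjoint (there (here refl) , there (here e)) = py≢x (cong proj₁ e)

      stage₁ : ∀ C₀ cL → C₀ ++ [ cL ] ⊆ W → proj₁ cL ≡ x →
               ∃ λ W₁ → Extension W (_∈ PX ∷ X ∷ []) W₁ × (C₀ ++ [ cL ]) ++ [ X ] ⊆ W₁
      stage₁ C₀ cL@(_ , _) C⊆W refl with ∷ʳ-⊆-split C₀ C⊆W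
      ... | P , Q , refl , C₀⊆P =
        P ++ cL ∷ PX ∷ X ∷ Q ,
        Extension-↭ (↭-insertAfter P cL (PX ∷ X ∷ []) Q)
          (Cyclic-insertAfter P cL Q [ PX ] X id (Adjacent-partner x<M ∷ Adjacent-sym (Adjacent-partner x<M) ∷ [-])
            (IsHamiltonian.cyclic H))
          (IsHamiltonian.unique H) ((x≢px ∘ sym ∘ cong proj₁ ∷ []) ∷ [] ∷ [])
          (fresh-disjoint H (new-label ∘ inj₁)) ,
        subst (_⊆ _) (sym (++-assoc C₀ [ cL ] [ X ])) (Sub.++⁺ C₀⊆P (refl ∷ PX ∷ʳ refl ∷ minimum Q))

      stage₂ : ∀ {W₁} c₁ C₁ → Extension W (_∈ PX ∷ X ∷ []) W₁ → (c₁ ∷ C₁) ++ [ X ] ⊆ W₁ → proj₁ c₁ ≡ y →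
               ∃ λ W₂ → Extension W₁ (_∈ Y ∷ PY ∷ []) W₂ × Y ∷ (c₁ ∷ C₁) ++ [ X ] ⊆ W₂
      stage₂ c₁@(_ , _) C₁ X₁ C⊆W₁ refl with ∷-⊆-split C⊆W₁
      ... | P , Q , refl , C₁⊆Q =
        P ++ Y ∷ PY ∷ c₁ ∷ Q ,
        Extension-↭ (shifts P (Y ∷ PY ∷ []))
          (Cyclic-insertBefore P c₁ Q Y [ PY ] id (Adjacent-partner y<M ∷ Adjacent-sym (Adjacent-partner y<M) ∷ [-])
            (Extension.cyclic X₁))
          (Extension.unique X₁) ((y≢py ∘ cong proj₁ ∷ []) ∷ [] ∷ []) disjoint ,
        Sub.++⁺ˡ P (refl ∷ PY ∷ʳ refl ∷ C₁⊆Q)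
        where
        disjoint : Disjoint (Y ∷ PY ∷ []) (P ++ c₁ ∷ Q)
        disjoint (z∈ , z∈W₁) with Extension.sound X₁ z∈W₁
        ... | inj₁ z∈W = fresh-disjoint H (new-label ∘ inj₂) (z∈ , z∈W)
        ... | inj₂ z∈new = new-disjoint (z∈ , z∈new)

      stage₃ : ∀ {W₂} → Extension W (λ z → z ∈ PX ∷ X ∷ [] ⊎ z ∈ Y ∷ PY ∷ []) W₂ →
               Extension W₂ (λ z → Any ((z ∈_) ∘ pairs) W₂) (concatMap (λ u → u ∷ pairs u) W₂)
      stage₃ {W₂} X₁₂ =
        Extension-concatMap pairs detour (Extension.cyclic X₁₂) (Extension.unique X₁₂)
          (λ {u} _ → Unique-pairs u) disjoint
        where
        not-pair : ∀ {u z} → z ∈ W₂ → ¬ PairOf u z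
        not-pair z∈ pz with Extension.sound X₁₂ z∈
        ... | inj₁ z∈W = <⇒≢ (proj₂ (IsHamiltonian.sound H z∈W)) (proj₁ (proj₂ (proj₂ (proj₂ pz))))
        ... | inj₂ new = PairOf-¬special pz (new-special new)
        disjoint : ∀ {u v} → u ∈ W₂ → v ∈ W₂ → u ≢ v → Disjoint (u ∷ pairs u) (v ∷ pairs v)
        disjoint {u} {v} u∈ v∈ u≢v (here refl , here refl) = u≢v refl
        disjoint {u} {v} u∈ v∈ u≢v (here refl , there z∈pv) = not-pair u∈ (pairs-sound v z∈pv)
        disjoint {u} {v} u∈ v∈ u≢v (there z∈pu , here refl) = not-pair v∈ (pairs-sound u z∈pu)
        disjoint {u} {v} u∈ v∈ u≢v (there z∈pu , there z∈pv) =
          u≢v (PairOf-unique (pairs-sound u z∈pu) (pairs-sound v z∈pv))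

      private
        new-layer : ∀ {z} → z ∈ PX ∷ X ∷ [] ⊎ z ∈ Y ∷ PY ∷ [] → Layer k z
        new-layer (inj₁ (here refl)) = partner-< x<M , refl
        new-layer (inj₁ (there (here refl))) = x<M , refl
        new-layer (inj₂ (here refl)) = y<M , refl
        new-layer (inj₂ (there (here refl))) = partner-< y<M , refl

        pair-layer : ∀ {u z} → PairOf u z → Layer k z
        pair-layer {z = c , .k} (b , _ , (b<M , _) , refl , inj₁ refl) = b<M , refl
        pair-layer {z = c , .k} (b , _ , (b<M , _) , refl , inj₂ refl) = next-< b<M , refl

      thread-matching : ∀ c₁ C₁ C₀ cL → c₁ ∷ C₁ ≡ C₀ ++ [ cL ] → c₁ ∷ C₁ ⊆ W → proj₁ c₁ ≡ y → proj₁ cL ≡ x →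
                        HamThrough (suc k) ((c₁ ∷ C₁) ++ X ∷ Y ∷ [])
      thread-matching c₁ C₁ C₀ cL C≡ C⊆W c₁≡y cL≡x with stage₁ C₀ cL (subst (_⊆ W) C≡ C⊆W) cL≡x
      ... | W₁ , X₁ , CX⊆W₁ with stage₂ c₁ C₁ X₁ (subst (λ C → C ++ [ X ] ⊆ W₁) (sym C≡) CX⊆W₁) c₁≡y
      ...   | W₂ , X₂ , YCX⊆W₂ =
        subst (HamThrough (suc k)) (++-assoc (c₁ ∷ C₁) [ X ] [ Y ])
          (HamThrough-rotate [ Y ] ((c₁ ∷ C₁) ++ [ X ])
            (_ , Extension⇒IsHamCycle H (Extension-trans X₁₂ (stage₃ X₁₂)) new⇒layer layer⇒new ,
             ⊆-trans YCX⊆W₂ (⊆-concatMap pairs W₂)))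
        where
        X₁₂ = Extension-trans X₁ X₂
        new⇒layer : ∀ {z} → (z ∈ PX ∷ X ∷ [] ⊎ z ∈ Y ∷ PY ∷ []) ⊎ Any ((z ∈_) ∘ pairs) W₂ → Layer k z
        new⇒layer (inj₁ new) = new-layer new
        new⇒layer (inj₂ z∈pairs) = let (u , _ , z∈pu) = find z∈pairs in pair-layer (pairs-sound u z∈pu)
        layer⇒new : ∀ {z} → Layer k z → (z ∈ PX ∷ X ∷ [] ⊎ z ∈ Y ∷ PY ∷ []) ⊎ Any ((z ∈_) ∘ pairs) W₂
        layer⇒new {c , .k} (c<M , refl) with base c ≟ base x | base c ≟ base y
        ... | yes bc≡bx | _ =
          inj₁ (inj₁ (Sum.[ there ∘ here ∘ cong (_, k) , here ∘ cong (_, k) ] (same-base c<M x<M bc≡bx)))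
        ... | no _ | yes bc≡by =
          inj₁ (inj₂ (Sum.[ here ∘ cong (_, k) , there ∘ here ∘ cong (_, k) ] (same-base c<M y<M bc≡by)))
        ... | no bc≢bx | no bc≢by =
          inj₂ (lose (Extension.keeps X₁₂ (IsHamiltonian.complete H (base-< c<M , 1≤k)))
                     (pairs-complete (base-< c<M , base-parity c<M , bc≢bx , bc≢by) (base-cover c<M)))

    thread : 1 ≤ k → ∀ C → C ⊆ W → HamThrough (suc k) (C ++ (x , k) ∷ (y , k) ∷ [])
    thread 1≤k [] _ =
      HamThrough-⊆ ((0 , 0) ∷ʳ ⊆-refl) (thread 1≤k [ 0 , 0 ] (from∈ (IsHamiltonian.complete H (0<M , 1≤k))))
    thread 1≤k (c₁ ∷ C₁) C⊆W with y ≟ proj₁ c₁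
    ... | no y≢c₁ = thread-before c₁ C₁ C⊆W y≢c₁
    ... | yes y≡c₁ with unsnoc c₁ C₁
    ...   | C₀ , cL , C≡ with x ≟ proj₁ cL
    ...     | no x≢cL =
      subst (λ C → HamThrough (suc k) (C ++ _)) (sym C≡) (thread-after C₀ cL (subst (_⊆ W) C≡ C⊆W) x≢cL)
    ...     | yes x≡cL = ThroughMatching.thread-matching 1≤k c₁ C₁ C₀ cL C≡ C⊆W (sym y≡c₁) (sym x≡cL)

  module Relabel (k : ℕ) where

    swap : ℕ → ℕ → ℕ
    swap s i with i ≟ s | i ≟ k
    ... | yes _ | _ = k
    ... | no _ | yes _ = s
    ... | no _ | no _ = i

    swap-self : ∀ s → swap s s ≡ k
    swap-self s with s ≟ s
    ... | yes _ = refl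
    ... | no s≢s = ⊥-elim (s≢s refl)

    swap-involutive : ∀ s i → swap s (swap s i) ≡ i
    swap-involutive s i with i ≟ s | i ≟ k
    ... | yes refl | _ with k ≟ i | k ≟ k
    ...   | yes k≡i | _ = k≡i
    ...   | no _ | yes _ = refl
    ...   | no _ | no k≢k = ⊥-elim (k≢k refl)
    swap-involutive s i | no _ | yes refl with s ≟ s
    ...   | yes _ = refl
    ...   | no s≢s = ⊥-elim (s≢s refl)
    swap-involutive s i | no i≢s | no i≢k with i ≟ s | i ≟ k
    ...   | yes i≡s | _ = ⊥-elim (i≢s i≡s)
    ...   | no _ | yes i≡k = ⊥-elim (i≢k i≡k)
    ...   | no _ | no _ = refl

    swap-< : ∀ {s i} → s < suc k → i < suc k → swap s i < suc k
    swap-< {s} {i} s<1+k i<1+k with i ≟ s | i ≟ k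
    ... | yes _ | _ = ≤-refl
    ... | no _ | yes _ = s<1+k
    ... | no _ | no _ = i<1+k

    swap-≢ : ∀ {s i} → i ≢ s → swap s i ≢ k
    swap-≢ {s} {i} i≢s with i ≟ s | i ≟ k
    ... | yes i≡s | _ = ⊥-elim (i≢s i≡s)
    ... | no _ | yes refl = i≢s ∘ sym
    ... | no _ | no i≢k = i≢k

    relabel : (ℕ → ℕ) → Vertex → Vertex
    relabel t (c , i) = c , swap (t c) i

    relabel-involutive : ∀ t v → relabel t (relabel t v) ≡ v
    relabel-involutive t (c , i) = cong (c ,_) (swap-involutive (t c) i)

    HamThrough-relabel : ∀ {β} t → (∀ {c} → c < M → t c < suc k) →
                         HamThrough (suc k) β → HamThrough (suc k) (map (relabel t) β)
    HamThrough-relabel t t< (W , H , β⊆W) =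
      map (relabel t) W ,
      IsHamiltonian-map (relabel t) (relabel-involutive t) id
        (λ { {c , i} (c<M , i<) → c<M , swap-< (t< c<M) i< }) H ,
      Sub.map⁺ (relabel t) β⊆W

    module Lift (1≤k : 1 ≤ k) (IH : ∀ β → Admissible k β → HamThrough k β)
                (C : List Vertex) (xa la xb lb : ℕ) (adm : Admissible (suc k) (C ++ (xa , la) ∷ (xb , lb) ∷ []))
                (xa≢xb : xa ≢ xb)
                (missing : ∀ {c} → c < M → c ≢ xa → c ≢ xb →
                           ∃ λ i → i < suc k × (c , i) ∉ C ++ (xa , la) ∷ (xb , lb) ∷ [])
                where

      open Admissible adm

      a∈ : (xa , la) ∈ C ++ (xa , la) ∷ (xb , lb) ∷ []
      a∈ = ∈-++⁺ʳ C (here refl)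

      b∈ : (xb , lb) ∈ C ++ (xa , la) ∷ (xb , lb) ∷ []
      b∈ = ∈-++⁺ʳ C (there (here refl))

      -- The label of block c that is exchanged with the new label k: the labels of a and b in
      -- their blocks, a label missing from β in the other blocks, and junk outside the cycle.
      target : ℕ → ℕ
      target c with c ≟ xa | c ≟ xb | c <? M
      ... | yes _ | _ | _ = la
      ... | no _ | yes _ | _ = lb
      ... | no c≢xa | no c≢xb | yes c<M = proj₁ (missing c<M c≢xa c≢xb)
      ... | no _ | no _ | no _ = 0

      target-a : target xa ≡ la
      target-a with xa ≟ xa
      ... | yes _ = refl
      ... | no xa≢xa = ⊥-elim (xa≢xa refl)

      target-b : target xb ≡ lb
      target-b with xb ≟ xa | xb ≟ xb
      ... | yes xb≡xa | _ = ⊥-elim (xa≢xb (sym xb≡xa))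
      ... | no _ | yes _ = refl
      ... | no _ | no xb≢xb = ⊥-elim (xb≢xb refl)

      target-< : ∀ {c} → c < M → target c < suc k
      target-< {c} c<M with c ≟ xa | c ≟ xb | c <? M
      ... | yes _ | _ | _ = proj₂ (valid a∈)
      ... | no _ | yes _ | _ = proj₂ (valid b∈)
      ... | no c≢xa | no c≢xb | yes c<M′ = proj₁ (proj₂ (missing c<M′ c≢xa c≢xb))
      ... | no _ | no _ | no c≮M = ⊥-elim (c≮M c<M)

      target-free : ∀ {c i} → (c , i) ∈ C → i ≢ target c
      target-free {c} {i} v∈C i≡t with c ≟ xa | c ≟ xb | c <? M
      ... | yes refl | _ | _ = Unique-++⇒Disjoint C unique (v∈C , here (cong (c ,_) i≡t))
      ... | no _ | yes refl | _ = Unique-++⇒Disjoint C unique (v∈C , there (here (cong (c ,_) i≡t)))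
      ... | no c≢xa | no c≢xb | yes c<M =
        proj₂ (proj₂ (missing c<M c≢xa c≢xb)) (subst (λ j → (c , j) ∈ _) i≡t (∈-++⁺ˡ v∈C))
      ... | no _ | no _ | no c≮M = c≮M (proj₁ (valid (∈-++⁺ˡ v∈C)))

      φ : Vertex → Vertex
      φ = relabel target

      C′ : List Vertex
      C′ = map φ C

      C′-admissible : Admissible k C′
      C′-admissible = record
        { unique = Unique.map⁺ φ-injective (Unique-⊆ (Sub.++⁺ʳ _ ⊆-refl) unique)
        ; valid  = valid′
        ; short  = subst (_≤ suc (k + k)) (sym (length-map φ C)) short′ }
        where
        φ-injective : ∀ {u v} → φ u ≡ φ v → u ≡ v
        φ-injective {u} {v} e =
          trans (sym (relabel-involutive target u)) (trans (cong φ e) (relabel-involutive target v))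
        valid′ : ∀ {v} → v ∈ C′ → Valid k v
        valid′ v∈ with ∈-map⁻ φ v∈
        ... | (c , i) , v∈C , refl with valid (∈-++⁺ˡ v∈C)
        ...   | c<M , i<1+k = c<M , ≤∧≢⇒< (s≤s⁻¹ (swap-< (target-< c<M) i<1+k)) (swap-≢ (target-free v∈C))
        short′ : length C ≤ suc (k + k)
        short′ = s≤s⁻¹ (s≤s⁻¹ (subst₂ _≤_ (trans (length-++ C) (+-comm (length C) 2))
                                          (cong (suc ∘ suc) (+-suc k k)) short))

      lift : HamThrough (suc k) (C ++ (xa , la) ∷ (xb , lb) ∷ [])
      lift with IH C′ C′-admissible
      ... | W′ , H′ , C′⊆W′ =
        subst (HamThrough (suc k)) φφβ≡β
          (HamThrough-relabel target target-<
            (subst (HamThrough (suc k)) C′ab≡φβ (thread H′ (proj₁ (valid a∈)) (proj₁ (valid b∈)) xa≢xb 1≤k C′ C′⊆W′)))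
        where
        β = C ++ (xa , la) ∷ (xb , lb) ∷ []
        C′ab≡φβ : C′ ++ (xa , k) ∷ (xb , k) ∷ [] ≡ map φ β
        C′ab≡φβ = begin
          C′ ++ (xa , k) ∷ (xb , k) ∷ []           ≡⟨ cong₂ (λ i j → C′ ++ (xa , i) ∷ (xb , j) ∷ [])
                                                        (sym (trans (cong (λ s → swap s la) target-a) (swap-self la)))
                                                        (sym (trans (cong (λ s → swap s lb) target-b) (swap-self lb))) ⟩
          C′ ++ map φ ((xa , la) ∷ (xb , lb) ∷ []) ≡⟨ sym (map-++ φ C _) ⟩
          map φ β                                 ∎
          where open ≡-Reasoning
        φφβ≡β : map φ (map φ β) ≡ β
        φφβ≡β = trans (sym (map-∘ β)) (trans (map-cong (relabel-involutive target) β) (map-id β))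

  Admissible-resp-↭ : ∀ {k β γ} → β ↭ γ → Admissible k β → Admissible k γ
  Admissible-resp-↭ β↭γ adm = record
    { unique = Unique-resp-↭ β↭γ unique
    ; valid  = valid ∘ ∈-resp-↭ (↭-sym β↭γ)
    ; short  = subst (_≤ _) (↭-length β↭γ) short }
    where open Admissible adm

  module Step (k : ℕ) (1≤k : 1 ≤ k) (IH : ∀ β → Admissible k β → HamThrough k β) where

    K : ℕ
    K = suc k

    Heavy : List Vertex → ℕ → Set
    Heavy β c = ∀ {i} → i < K → (c , i) ∈ β

    heavy-or-missing : ∀ β c → Heavy β c ⊎ ∃ λ i → i < K × (c , i) ∉ β
    heavy-or-missing β c with anyUpTo? (λ i → ¬? ((c , i) ∈? β)) K
    ... | yes (i , i<K , ci∉β) = inj₂ (i , i<K , ci∉β)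
    ... | no none = inj₁ (λ {i} i<K → decidable-stable ((c , i) ∈? β) (λ ci∉β → none (i , i<K , ci∉β)))

    heavy? : ∀ β c → Dec (Heavy β c)
    heavy? β c with heavy-or-missing β c
    ... | inj₁ heavy = yes heavy
    ... | inj₂ (i , i<K , ci∉β) = no (λ heavy → ci∉β (heavy i<K))

    finish : ∀ {β} → Admissible K β → ∀ U a b V → β ≡ U ++ a ∷ b ∷ V → proj₁ a ≢ proj₁ b →
             (∀ {c} → c < M → c ≢ proj₁ a → c ≢ proj₁ b → ¬ Heavy β c) → HamThrough K β
    finish {β} adm U (xa , la) (xb , lb) V refl xa≢xb light =
      subst (HamThrough K) (++-assoc U ab V)
        (HamThrough-rotate V (U ++ ab)
          (subst (HamThrough K) (++-assoc V U ab)
            (Relabel.Lift.lift k 1≤k IH (V ++ U) xa la xb lb (Admissible-resp-↭ rotation adm) xa≢xb missing)))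
      where
      ab = (xa , la) ∷ (xb , lb) ∷ []
      rotation : U ++ ab ++ V ↭ (V ++ U) ++ ab
      rotation = ↭-trans (↭-reflexive (sym (++-assoc U ab V)))
                   (↭-trans (↭-++-comm (U ++ ab) V) (↭-reflexive (sym (++-assoc V U ab))))
      missing : ∀ {c} → c < M → c ≢ xa → c ≢ xb → ∃ λ i → i < K × (c , i) ∉ (V ++ U) ++ ab
      missing {c} c<M c≢xa c≢xb with heavy-or-missing β c
      ... | inj₁ heavy = ⊥-elim (light c<M c≢xa c≢xb heavy)
      ... | inj₂ (i , i<K , ci∉β) = i , i<K , ci∉β ∘ ∈-resp-↭ (↭-sym rotation)

    column : ℕ → List Vertex
    column c = map (c ,_) (upTo K)

    private
      length-column : ∀ c → length (column c) ≡ K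
      length-column c = trans (length-map (c ,_) (upTo K)) (length-upTo K)

      Unique-column : ∀ c → Unique (column c)
      Unique-column c = Unique.map⁺ (λ { refl → refl }) (Unique.upTo⁺ K)

      ∈-column⁻ : ∀ {c v} → v ∈ column c → proj₁ v ≡ c
      ∈-column⁻ {c} v∈ with ∈-map⁻ (c ,_) v∈
      ... | _ , _ , refl = refl

      column-disjoint : ∀ {c d} → c ≢ d → Disjoint (column c) (column d)
      column-disjoint c≢d (v∈c , v∈d) = c≢d (trans (sym (∈-column⁻ v∈c)) (∈-column⁻ v∈d))

      column-⊆ : ∀ {β c v} → Heavy β c → v ∈ column c → v ∈ β
      column-⊆ {c = c} heavy v∈ with ∈-map⁻ (c ,_) v∈
      ... | i , i∈ , refl = heavy (∈-upTo⁻ i∈)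

      length-bound : ∀ {β L} → Admissible K β → Unique L → (∀ {v} → v ∈ L → v ∈ β) → length L ≤ suc (K + K)
      length-bound adm uL L⊆β = ≤-trans (Unique-length-≤ uL L⊆β) (Admissible.short adm)

      two-columns : ℕ → ℕ → List Vertex
      two-columns c d = column c ++ column d

      length-two-columns : ∀ c d → length (two-columns c d) ≡ K + K
      length-two-columns c d = trans (length-++ (column c)) (cong₂ _+_ (length-column c) (length-column d))

      Unique-two-columns : ∀ {c d} → c ≢ d → Unique (two-columns c d)
      Unique-two-columns {c} {d} c≢d = Unique.++⁺ (Unique-column c) (Unique-column d) (column-disjoint c≢d)

      two-columns-⊆ : ∀ {β c d v} → Heavy β c → Heavy β d → v ∈ two-columns c d → v ∈ β
      two-columns-⊆ {c = c} heavy₁ heavy₂ v∈ = Sum.[ column-⊆ heavy₁ , column-⊆ heavy₂ ] (∈-++⁻ (column c) v∈)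

      ∈-two-columns⁻ : ∀ {c d v} → v ∈ two-columns c d → proj₁ v ≡ c ⊎ proj₁ v ≡ d
      ∈-two-columns⁻ {c} v∈ = Sum.map ∈-column⁻ ∈-column⁻ (∈-++⁻ (column c) v∈)

    at-most-two-heavy : ∀ {β c₁ c₂} → Admissible K β → Heavy β c₁ → Heavy β c₂ → c₁ ≢ c₂ →
                        ∀ {c₃} → c₃ ≢ c₁ → c₃ ≢ c₂ → ¬ Heavy β c₃
    at-most-two-heavy {β} {c₁} {c₂} adm heavy₁ heavy₂ c₁≢c₂ {c₃} c₃≢c₁ c₃≢c₂ heavy₃ =
      1+n≰n (≤-trans 1≤k (s≤s⁻¹ (+-cancelʳ-≤ (K + K) K 1 3K≤1+2K)))
      where
      L = column c₃ ++ two-columns c₁ c₂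
      uL : Unique L
      uL = Unique.++⁺ (Unique-column c₃) (Unique-two-columns c₁≢c₂)
             λ (v∈₃ , v∈₁₂) → Sum.[ c₃≢c₁ , c₃≢c₂ ] (Sum.map (trans (sym (∈-column⁻ v∈₃))) (trans (sym (∈-column⁻ v∈₃)))
                                                             (∈-two-columns⁻ v∈₁₂))
      L⊆β : ∀ {v} → v ∈ L → v ∈ β
      L⊆β = Sum.[ column-⊆ heavy₃ , two-columns-⊆ heavy₁ heavy₂ ] ∘ ∈-++⁻ (column c₃)
      3K≤1+2K : K + (K + K) ≤ 1 + (K + K)
      3K≤1+2K = subst (_≤ suc (K + K)) (trans (length-++ (column c₃)) (cong₂ _+_ (length-column c₃) (length-two-columns c₁ c₂)))
                  (length-bound adm uL L⊆β)

    Outside : ℕ → ℕ → Vertex → Set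
    Outside c₁ c₂ v = proj₁ v ≢ c₁ × proj₁ v ≢ c₂

    no-two-outside : ∀ {β c₁ c₂ z₁ z₂} → Admissible K β → Heavy β c₁ → Heavy β c₂ → c₁ ≢ c₂ →
                     z₁ ∈ β → z₂ ∈ β → z₁ ≢ z₂ → Outside c₁ c₂ z₁ → Outside c₁ c₂ z₂ → ⊥
    no-two-outside {β} {c₁} {c₂} {z₁} {z₂} adm heavy₁ heavy₂ c₁≢c₂ z₁∈ z₂∈ z₁≢z₂ out₁ out₂ =
      1+n≰n (subst (_≤ suc (K + K)) (cong (suc ∘ suc) (length-two-columns c₁ c₂)) (length-bound adm uL L⊆β))
      where
      ∉columns : ∀ {z} → Outside c₁ c₂ z → z ∉ two-columns c₁ c₂
      ∉columns (≢c₁ , ≢c₂) = Sum.[ ≢c₁ , ≢c₂ ] ∘ ∈-two-columns⁻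
      uL : Unique (z₁ ∷ z₂ ∷ two-columns c₁ c₂)
      uL = ¬Any⇒All¬ _ (λ { (here z₁≡z₂) → z₁≢z₂ z₁≡z₂ ; (there z₁∈) → ∉columns out₁ z₁∈ })
         ∷ ¬Any⇒All¬ _ (∉columns out₂)
         ∷ Unique-two-columns c₁≢c₂
      L⊆β : ∀ {v} → v ∈ z₁ ∷ z₂ ∷ two-columns c₁ c₂ → v ∈ β
      L⊆β (here refl) = z₁∈
      L⊆β (there (here refl)) = z₂∈
      L⊆β (there (there v∈)) = two-columns-⊆ heavy₁ heavy₂ v∈

    Straddles : ℕ → Vertex → Vertex → Set
    Straddles h a b = (proj₁ a ≡ h × proj₁ b ≢ h) ⊎ (proj₁ a ≢ h × proj₁ b ≡ h)

    private
      inBlock : ℕ → Vertex → Bool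
      inBlock h v with proj₁ v ≟ h
      ... | yes _ = true
      ... | no _ = false

      inBlock-differs : ∀ {h x y} → proj₁ x ≡ h → proj₁ y ≢ h → inBlock h x ≢ inBlock h y
      inBlock-differs {h} {x} {y} x≡h y≢h with proj₁ x ≟ h | proj₁ y ≟ h
      ... | yes _ | no _ = λ ()
      ... | no x≢h | _ = ⊥-elim (x≢h x≡h)
      ... | _ | yes y≡h = ⊥-elim (y≢h y≡h)

      inBlock-straddles : ∀ {h a b} → inBlock h a ≢ inBlock h b → Straddles h a b
      inBlock-straddles {h} {a} {b} differ with proj₁ a ≟ h | proj₁ b ≟ h
      ... | yes a≡h | no b≢h = inj₁ (a≡h , b≢h)
      ... | no a≢h | yes b≡h = inj₂ (a≢h , b≡h)
      ... | yes _ | yes _ = ⊥-elim (differ refl)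
      ... | no _ | no _ = ⊥-elim (differ refl)

    Straddles⇒≢ : ∀ {h a b} → Straddles h a b → proj₁ a ≢ proj₁ b
    Straddles⇒≢ (inj₁ (a≡h , b≢h)) a≡b = b≢h (trans (sym a≡b) a≡h)
    Straddles⇒≢ (inj₂ (a≢h , b≡h)) a≡b = a≢h (trans a≡b b≡h)

    straddling : ∀ β {h x y} → x ∈ β → y ∈ β → proj₁ x ≡ h → proj₁ y ≢ h →
                 ∃₂ λ U V → ∃₂ λ a b → β ≡ U ++ a ∷ b ∷ V × Straddles h a b
    straddling β x∈ y∈ x≡h y≢h with consecutive-≢ Bool._≟_ (inBlock _) β x∈ y∈ (inBlock-differs x≡h y≢h)
    ... | U , V , a , b , β≡ , differ = U , V , a , b , β≡ , inBlock-straddles differ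

    select-one : ∀ {β h w} → Admissible K β → Heavy β h → (∀ {c} → c < M → c ≢ h → ¬ Heavy β c) →
                 w ∈ β → proj₁ w ≢ h → HamThrough K β
    select-one {β} {h} adm heavy only-h w∈ w≢h with straddling β (heavy (s≤s z≤n)) w∈ refl w≢h
    ... | U , V , a , b , β≡ , straddles = finish adm U a b V β≡ (Straddles⇒≢ {h} {a} {b} straddles) light
      where
      light : ∀ {c} → c < M → c ≢ proj₁ a → c ≢ proj₁ b → ¬ Heavy β c
      light c<M c≢a c≢b = only-h c<M (Sum.[ (λ (a≡h , _) c≡h → c≢a (trans c≡h (sym a≡h)))
                                          , (λ (_ , b≡h) c≡h → c≢b (trans c≡h (sym b≡h))) ] straddles)

    private
      in-second : ∀ {h₁ h₂ v} → ¬ Outside h₁ h₂ v → proj₁ v ≢ h₁ → proj₁ v ≡ h₂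
      in-second {h₂ = h₂} {v} not-out v≢h₁ with proj₁ v ≟ h₂
      ... | yes v≡h₂ = v≡h₂
      ... | no v≢h₂ = ⊥-elim (not-out (v≢h₁ , v≢h₂))

      two-light : ∀ {β h₁ h₂ a b} → (∀ {c} → c ≢ h₁ → c ≢ h₂ → ¬ Heavy β c) → Straddles h₁ a b →
                  ¬ Outside h₁ h₂ a → ¬ Outside h₁ h₂ b → ∀ {c} → c < M → c ≢ proj₁ a → c ≢ proj₁ b → ¬ Heavy β c
      two-light {h₁ = h₁} {h₂} {a} {b} third (inj₁ (a≡h₁ , b≢h₁)) _ b-in _ c≢a c≢b =
        third (λ c≡h₁ → c≢a (trans c≡h₁ (sym a≡h₁)))
              (λ c≡h₂ → c≢b (trans c≡h₂ (sym (in-second {h₁} {h₂} {b} b-in b≢h₁))))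
      two-light {h₁ = h₁} {h₂} {a} {b} third (inj₂ (a≢h₁ , b≡h₁)) a-in _ _ c≢a c≢b =
        third (λ c≡h₁ → c≢b (trans c≡h₁ (sym b≡h₁)))
              (λ c≡h₂ → c≢a (trans c≡h₂ (sym (in-second {h₁} {h₂} {a} a-in a≢h₁))))

      outside? : ∀ h₁ h₂ v → Dec (Outside h₁ h₂ v)
      outside? h₁ h₂ v = ¬? (proj₁ v ≟ h₁) ×-dec ¬? (proj₁ v ≟ h₂)

    select-two-inside : ∀ {β h₁ h₂} → Admissible K β → Heavy β h₁ → Heavy β h₂ → h₁ ≢ h₂ →
                        (∀ {c} → c ≢ h₁ → c ≢ h₂ → ¬ Heavy β c) → (∀ {v} → v ∈ β → ¬ Outside h₁ h₂ v) → HamThrough K β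
    select-two-inside {β} {h₁} {h₂} adm heavy₁ heavy₂ h₁≢h₂ third inside
      with straddling β (heavy₁ (s≤s z≤n)) (heavy₂ (s≤s z≤n)) refl (h₁≢h₂ ∘ sym)
    ... | U , V , a , b , refl , straddles =
      finish adm U a b V refl (Straddles⇒≢ {h₁} {a} {b} straddles)
        (two-light {β} {h₁} {h₂} {a} {b} third straddles
          (inside (∈-++⁺ʳ U (here refl))) (inside (∈-++⁺ʳ U (there (here refl)))))

    select-two-outside : ∀ A z B {h₁ h₂} → Admissible K (A ++ z ∷ B) →
                         Heavy (A ++ z ∷ B) h₁ → Heavy (A ++ z ∷ B) h₂ → h₁ ≢ h₂ →
                         (∀ {c} → c ≢ h₁ → c ≢ h₂ → ¬ Heavy (A ++ z ∷ B) c) → Outside h₁ h₂ z →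
                         HamThrough K (z ∷ B ++ A)
    select-two-outside A z B {h₁} {h₂} adm heavy₁ heavy₂ h₁≢h₂ third z-out =
      finish-from (straddling (B ++ A) (rest (heavy₁ (s≤s z≤n)) (proj₁ z-out ∘ sym ∘ cong proj₁))
                                       (rest (heavy₂ (s≤s z≤n)) (proj₂ z-out ∘ sym ∘ cong proj₁)) refl (h₁≢h₂ ∘ sym))
      where
      rotation : A ++ z ∷ B ↭ z ∷ B ++ A
      rotation = ↭-++-comm A (z ∷ B)
      adm′ : Admissible K (z ∷ B ++ A)
      adm′ = Admissible-resp-↭ rotation adm
      z∉BA : z ∉ B ++ A
      z∉BA = Unique[x∷xs]⇒x∉xs (Admissible.unique adm′)
      rest : ∀ {v} → v ∈ A ++ z ∷ B → v ≢ z → v ∈ B ++ A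
      rest v∈ v≢z with ∈-resp-↭ rotation v∈
      ... | here v≡z = ⊥-elim (v≢z v≡z)
      ... | there v∈BA = v∈BA
      inside : ∀ {v} → v ∈ B ++ A → ¬ Outside h₁ h₂ v
      inside {v} v∈ v-out = no-two-outside adm heavy₁ heavy₂ h₁≢h₂ (∈-resp-↭ (↭-sym rotation) (there v∈))
                              (∈-resp-↭ (↭-sym rotation) (here refl)) (λ { refl → z∉BA v∈ }) v-out z-out
      finish-from : (∃₂ λ U V → ∃₂ λ a b → B ++ A ≡ U ++ a ∷ b ∷ V × Straddles h₁ a b) → HamThrough K (z ∷ B ++ A)
      finish-from (U , V , a , b , BA≡ , straddles) =
        finish adm′ (z ∷ U) a b V (cong (z ∷_) BA≡) (Straddles⇒≢ {h₁} {a} {b} straddles)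
          (λ c<M c≢a c≢b heavy →
             two-light {A ++ z ∷ B} {h₁} {h₂} {a} {b} third straddles
               (inside (∈-BA (here refl))) (inside (∈-BA (there (here refl))))
               c<M c≢a c≢b (∈-resp-↭ (↭-sym rotation) ∘ heavy))
        where
        ∈-BA : ∀ {v} → v ∈ a ∷ b ∷ V → v ∈ B ++ A
        ∈-BA v∈ = subst (_ ∈_) (sym BA≡) (∈-++⁺ʳ U v∈)

    select : ∀ {β u v} → Admissible K β → u ∈ β → v ∈ β → proj₁ u ≢ proj₁ v → HamThrough K β
    select {β} {u} {v} adm u∈ v∈ u≢v with anyUpTo? (heavy? β) M
    ... | no no-heavy with consecutive-≢ _≟_ proj₁ β u∈ v∈ u≢v
    ...   | U , V , a , b , β≡ , a≢b = finish adm U a b V β≡ a≢b (λ c<M _ _ heavy → no-heavy (_ , c<M , heavy))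
    select {β} {u} {v} adm u∈ v∈ u≢v | yes (h₁ , _ , heavy₁) with anyUpTo? (λ c → ¬? (c ≟ h₁) ×-dec heavy? β c) M
    ... | no only-h₁ with proj₁ u ≟ h₁
    ...   | yes u≡h₁ = select-one adm heavy₁ (λ c<M c≢h₁ heavy → only-h₁ (_ , c<M , c≢h₁ , heavy))
                         v∈ (u≢v ∘ trans u≡h₁ ∘ sym)
    ...   | no u≢h₁ = select-one adm heavy₁ (λ c<M c≢h₁ heavy → only-h₁ (_ , c<M , c≢h₁ , heavy))
                        u∈ u≢h₁
    select {β} {u} {v} adm u∈ v∈ u≢v | yes (h₁ , _ , heavy₁) | yes (h₂ , _ , h₂≢h₁ , heavy₂)
      with any? (outside? h₁ h₂) β
    ... | no none = select-two-inside adm heavy₁ heavy₂ (h₂≢h₁ ∘ sym) (at-most-two-heavy adm heavy₁ heavy₂ (h₂≢h₁ ∘ sym))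
                      (λ v∈ v-out → none (lose v∈ v-out))
    ... | yes some with find some
    ...   | z , z∈ , z-out with ∈-∃++ z∈
    ...     | A , B , refl = HamThrough-rotate (z ∷ B) A
                              (select-two-outside A z B adm heavy₁ heavy₂ (h₂≢h₁ ∘ sym)
                                 (at-most-two-heavy adm heavy₁ heavy₂ (h₂≢h₁ ∘ sym)) z-out)

    hamThrough-step : ∀ β → Admissible K β → HamThrough K β
    hamThrough-step [] _ = HamThrough-⊆ (minimum _) (hamThrough-step [ 0 , 0 ] singleton)
      where
      singleton : Admissible K [ 0 , 0 ]
      singleton = record { unique = [] ∷ [] ; valid = λ { (here refl) → 0<M , s≤s z≤n } ; short = s≤s z≤n }
    hamThrough-step (u ∷ us) adm with any? (λ v → ¬? (proj₁ v ≟ proj₁ u)) us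
    ... | yes some = let (v , v∈ , v≢u) = find some in select adm (here refl) (there v∈) (v≢u ∘ sym)
    ... | no none =
      -- β lies in one block, so it has at most K entries and can be padded by a vertex of the next block.
      HamThrough-⊆ (Sub.++⁺ʳ [ z ] ⊆-refl) (select padded (here refl) (∈-++⁺ʳ (u ∷ us) (here refl)) (next-≢ c<M ∘ sym))
      where
      open Admissible adm
      c = proj₁ u
      c<M = proj₁ (valid (here refl))
      z = next c , 0
      same-block : ∀ {v} → v ∈ u ∷ us → proj₁ v ≡ c
      same-block (here refl) = refl
      same-block {v} (there v∈) with proj₁ v ≟ c
      ... | yes v≡c = v≡c
      ... | no v≢c = ⊥-elim (none (lose v∈ v≢c))
      in-column : ∀ {v} → v ∈ u ∷ us → v ∈ column c
      in-column {v} v∈ with same-block v∈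
      ... | refl = ∈-map⁺ (proj₁ v ,_) (∈-upTo⁺ (proj₂ (valid v∈)))
      length≤K : length (u ∷ us) ≤ K
      length≤K = subst (length (u ∷ us) ≤_) (length-column c) (Unique-length-≤ unique in-column)
      padded : Admissible K ((u ∷ us) ++ [ z ])
      padded = record
        { unique = Unique.++⁺ unique ([] ∷ []) λ { (v∈ , here refl) → next-≢ c<M (same-block v∈) }
        ; valid  = λ v∈ → Sum.[ valid , (λ { (here refl) → next-< c<M , s≤s z≤n }) ] (∈-++⁻ (u ∷ us) v∈)
        ; short  = subst (_≤ suc (K + K)) (sym (trans (length-++ (u ∷ us)) (+-comm (length (u ∷ us)) 1)))
                     (s≤s (≤-trans length≤K (m≤m+n K K))) }

  hamThrough : ∀ k → 1 ≤ k → ∀ β → Admissible k β → HamThrough k β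
  hamThrough 1 _ = hamThrough₁
  hamThrough (suc (suc k)) _ = Step.hamThrough-step (suc k) (s≤s z≤n) (hamThrough (suc k) (s≤s z≤n))

module Construction (h k : ℕ) (1≤k : 1 ≤ k) where
  open Blowup h

  n : ℕ
  n = k * M

  decode : Fin n → Vertex
  decode x = toℕ x % M , toℕ x / M

  block : Fin n → ℕ
  block x = toℕ x % M

  decode-valid : ∀ x → Valid k (decode x)
  decode-valid x = m%n<n (toℕ x) M , m<n*o⇒m/o<n (toℕ<n x)

  private
    recompose : ∀ x → toℕ x ≡ proj₁ (decode x) + proj₂ (decode x) * M
    recompose x = m≡m%n+[m/n]*n (toℕ x) M

  decode-injective : ∀ {x y} → decode x ≡ decode y → x ≡ y
  decode-injective {x} {y} e =
    toℕ-injective (trans (recompose x) (trans (cong (λ (c , i) → c + i * M) e) (sym (recompose y))))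

  encode : ∀ {v} → Valid k v → Fin n
  encode {c , i} (c<M , i<k) = fromℕ< (≤-trans (+-monoˡ-< (i * M) c<M) (*-monoˡ-≤ M i<k))

  decode-encode : ∀ {v} (v-valid : Valid k v) → decode (encode v-valid) ≡ v
  decode-encode {c , i} v-valid@(c<M , _) = cong₂ _,_ block≡c (sym i≡label)
    where
    x = encode v-valid
    toℕ-x : toℕ x ≡ c + i * M
    toℕ-x = toℕ-fromℕ< _
    block≡c : toℕ x % M ≡ c
    block≡c = trans (cong (_% M) toℕ-x) (trans ([m+kn]%n≡m%n c i M) (m<n⇒m%n≡m c<M))
    i≡label : i ≡ toℕ x / M
    i≡label = *-cancelʳ-≡ i (toℕ x / M) M
                (+-cancelˡ-≡ c _ _ (trans (sym toℕ-x)
                                    (trans (recompose x) (cong (λ d → d + (toℕ x / M) * M) block≡c))))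

  G : SimpleGraph n
  G = record
    { adj      = λ u v → does (adjacent? (block u) (block v))
    ; sym      = λ u v → does-≡ (adjacent? (block u) (block v)) (adjacent? (block v) (block u))
                                Adjacent-sym Adjacent-sym
    ; loopless = λ v → dec-false (adjacent? _ _) (λ u∼u → Adjacent⇒≢ (m%n<n (toℕ v) M) u∼u refl) }

  private
    adjacent-in-period : ∀ {b} → b < M → count (λ j → does (adjacent? b (j % M))) M ≡ 2
    adjacent-in-period {b} b<M = begin
      count (λ j → does (adjacent? b (j % M))) M                 ≡⟨ count-ext M adjacent⇔ ⟩
      count (λ j → does (j ≟ next b) ∨ does (j ≟ prev b)) M     ≡⟨ count-∨ M _ _ disjoint ⟩
      count (λ j → does (j ≟ next b)) M + count (λ j → does (j ≟ prev b)) M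
                                                                 ≡⟨ cong₂ _+_ (count-≟ (next-< b<M)) (count-≟ (prev-< b<M)) ⟩
      2                                                          ∎
      where
      open ≡-Reasoning
      adjacent⇔ : ∀ {j} → j < M → does (adjacent? b (j % M)) ≡ does (j ≟ next b) ∨ does (j ≟ prev b)
      adjacent⇔ {j} j<M rewrite m<n⇒m%n≡m j<M =
        cong₂ _∨_ (does-≡ (next b ≟ j) (j ≟ next b) sym sym)
                  (does-≡ (next j ≟ b) (j ≟ prev b) (λ e → trans (sym (prev-next j<M)) (cong prev e))
                                                     (λ e → trans (cong next e) (next-prev b<M)))
      disjoint : ∀ j → does (j ≟ next b) ≡ true → does (j ≟ prev b) ≡ false
      disjoint j j≡next =
        dec-false (j ≟ prev b) (next≢prev b<M ∘ trans (sym (≡ᵇ⇒≡ j (next b) (subst T (sym j≡next) tt))))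

  regular : Regular (2 * k) G
  regular v = begin
    length (filterᵇ (SimpleGraph.adj G v) (allFin n))        ≡⟨ length-filterᵇ-tabulate n id _ adjacent-to-v (λ _ → refl) ⟩
    count adjacent-to-v (k * M)                              ≡⟨ count-periodic M k periodic ⟩
    k * count adjacent-to-v M                                ≡⟨ cong (k *_) (adjacent-in-period (m%n<n (toℕ v) M)) ⟩
    k * 2                                                    ≡⟨ *-comm k 2 ⟩
    2 * k                                                    ∎
    where
    open ≡-Reasoning
    adjacent-to-v : ℕ → Bool
    adjacent-to-v j = does (adjacent? (block v) (j % M))
    periodic : ∀ j → adjacent-to-v (M + j) ≡ adjacent-to-v j
    periodic j = cong (λ d → does (adjacent? (block v) d)) (trans (cong (_% M) (+-comm M j)) ([m+n]%n≡m%n j M))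

  private
    vertices : List Vertex
    vertices = map decode (allFin n)

  length-IsHamCycle : ∀ {W} → IsHamCycle k W → length W ≡ n
  length-IsHamCycle {W} H =
    ≤-antisym (subst (length W ≤_) length-vertices (Unique-length-≤ unique (∈-vertices ∘ sound)))
              (subst (_≤ length W) length-vertices
                (Unique-length-≤ (Unique.map⁺ decode-injective (Unique.allFin⁺ n)) (complete ∘ vertices-valid)))
    where
    open IsHamiltonian H
    length-vertices : length vertices ≡ n
    length-vertices = trans (length-map decode (allFin n)) (length-tabulate id)
    ∈-vertices : ∀ {v} → Valid k v → v ∈ vertices
    ∈-vertices v-valid = subst (_∈ vertices) (decode-encode v-valid) (∈-map⁺ decode (∈-allFin (encode v-valid)))
    vertices-valid : ∀ {v} → v ∈ vertices → Valid k v
    vertices-valid v∈ with ∈-map⁻ decode v∈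
    ... | x , _ , refl = decode-valid x

  M≤n : M ≤ n
  M≤n = subst (_≤ n) (+-identityʳ M) (*-monoˡ-≤ M 1≤k)

  h≤n : h ≤ n
  h≤n = ≤-trans (≤-trans (m≤m+n h h) (m≤n+m (h + h) 4)) M≤n

  module FromWalk (w : Vertex) (ws : List Vertex) (H : IsHamCycle k (w ∷ ws)) where

    open IsHamiltonian H

    private
      W = w ∷ ws

      at : ℕ → Vertex
      at = nth (0 , 0) W

      <W : ∀ {j} → j < n → j < length W
      <W {j} = subst (j <_) (sym (length-IsHamCycle H))

      <W++w : ∀ {j} → j < length W → j < length (W ++ [ w ])
      <W++w {j} j< = subst (j <_) (sym (length-++ W)) (≤-trans j< (m≤m+n _ 1))

      at-++ : ∀ {j} → j < length W → nth (0 , 0) (W ++ [ w ]) j ≡ at j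
      at-++ = nth-++ˡ (0 , 0) W

      at-valid : ∀ i → Valid k (at (toℕ i))
      at-valid i = sound (nth-∈ (0 , 0) (<W (toℕ<n i)))

    σ′ : Fin n → Fin n
    σ′ i = encode (at-valid i)

    decode-σ′ : ∀ i → decode (σ′ i) ≡ at (toℕ i)
    decode-σ′ i = decode-encode (at-valid i)

    private
      adjacent-σ′ : ∀ i j → at (toℕ i) ∼ at (toℕ j) → SimpleGraph.adj G (σ′ i) (σ′ j) ≡ true
      adjacent-σ′ i j a =
        dec-true (adjacent? _ _) (subst₂ Adjacent (cong proj₁ (sym (decode-σ′ i))) (cong proj₁ (sym (decode-σ′ j))) a)

      σ′-injective : ∀ {i j} → σ′ i ≡ σ′ j → i ≡ j
      σ′-injective {i} {j} e = toℕ-injective (Unique-nth-injective (0 , 0) unique (<W (toℕ<n i)) (<W (toℕ<n j))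
                                 (trans (sym (decode-σ′ i)) (trans (cong decode e) (decode-σ′ j))))

      step′ : ∀ i j → toℕ j ≡ suc (toℕ i) → SimpleGraph.adj G (σ′ i) (σ′ j) ≡ true
      step′ i j j≡ = adjacent-σ′ i j (subst₂ _∼_ (at-++ (<W (toℕ<n i))) (trans (at-++ j<W) (cong at (sym j≡)))
                                        (Linked-nth (0 , 0) cyclic (<W++w j<W)))
        where
        j<W : suc (toℕ i) < length W
        j<W = <W (subst (_< n) j≡ (toℕ<n j))

      close′ : ∀ i j → toℕ i ≡ n ∸ 1 → toℕ j ≡ 0 → SimpleGraph.adj G (σ′ i) (σ′ j) ≡ true
      close′ i j i≡ j≡ =
        adjacent-σ′ i j (subst₂ _∼_ (trans (at-++ ≤-refl) (cong at (sym i≡′)))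
                                   (trans (nth-++-length (0 , 0) ws) (cong at (sym j≡)))
                           (Linked-nth (0 , 0) cyclic last<))
        where
        i≡′ : toℕ i ≡ length ws
        i≡′ = trans i≡ (cong (_∸ 1) (sym (length-IsHamCycle H)))
        last< : suc (length ws) < length (W ++ [ w ])
        last< = s≤s (subst (length ws <_) (sym (trans (length-++ ws) (+-comm (length ws) 1))) ≤-refl)

    hamCycle : HamCycle G
    hamCycle = record
      { σ = σ′ ; σ-inj = σ′-injective ; three≤n = ≤-trans (s≤s (s≤s (s≤s z≤n))) M≤n ; step = step′ ; close = close′ }

    containsInOrder : ∀ {r} (v : Fin r → Fin n) → tabulate (decode ∘ v) ⊆ W → ContainsInOrder hamCycle v
    containsInOrder {r} v β⊆W = pos , increasing , hits
      where
      β = tabulate (decode ∘ v)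
      positions = ⊆-positions (0 , 0) β⊆W
      p = proj₁ positions
      <β : ∀ (i : Fin r) → toℕ i < length β
      <β i = subst (toℕ i <_) (sym (length-tabulate (decode ∘ v))) (toℕ<n i)
      pos : Fin r → Fin n
      pos i = fromℕ< (subst (p (toℕ i) <_) (length-IsHamCycle H) (proj₁ (proj₁ (proj₂ positions) (<β i))))
      toℕ-pos : ∀ i → toℕ (pos i) ≡ p (toℕ i)
      toℕ-pos i = toℕ-fromℕ< _
      increasing : ∀ i j → toℕ i < toℕ j → toℕ (pos i) < toℕ (pos j)
      increasing i j i<j rewrite toℕ-pos i | toℕ-pos j = proj₂ (proj₂ positions) i<j (<β j)
      hits : ∀ i → σ′ (pos i) ≡ v i
      hits i = decode-injective (begin
        decode (σ′ (pos i))   ≡⟨ decode-σ′ (pos i) ⟩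
        at (toℕ (pos i))      ≡⟨ cong at (toℕ-pos i) ⟩
        at (p (toℕ i))        ≡⟨ proj₂ (proj₁ (proj₂ positions) (<β i)) ⟩
        nth (0 , 0) β (toℕ i) ≡⟨ nth-tabulate (0 , 0) (decode ∘ v) i ⟩
        decode (v i)          ∎)
        where open ≡-Reasoning

  sequence-admissible : ∀ (v : Fin (2 * k + 1) → Fin n) → Injective _≡_ _≡_ v → Admissible k (tabulate (decode ∘ v))
  sequence-admissible v v-injective = record
    { unique = Unique.tabulate⁺ (v-injective ∘ decode-injective)
    ; valid  = λ u∈ → let (i , u≡) = ∈-tabulate⁻ u∈ in subst (Valid k) (sym u≡) (decode-valid (v i))
    ; short  = ≤-reflexive (trans (length-tabulate (decode ∘ v))
                                  (trans (+-comm (2 * k) 1) (cong (λ t → suc (k + t)) (+-identityʳ k)))) }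

  ordered-hamiltonian : OrderedHamiltonian (2 * k + 1) G
  ordered-hamiltonian v v-injective with hamThrough k 1≤k (tabulate (decode ∘ v)) (sequence-admissible v v-injective)
  ... | [] , H , _ = ⊥-elim (IsHamiltonian.cyclic H)
  ... | w ∷ ws , H , β⊆W = FromWalk.hamCycle w ws H , FromWalk.containsInOrder w ws H v β⊆W

theorem2p2 : ∀ (k : ℕ) → 1 ≤ k → ∀ (m : ℕ) →
    Σ ℕ λ n → m ≤ n × Σ (SimpleGraph n) λ G →
    Regular (2 * k) G × OrderedHamiltonian (2 * k + 1) G
theorem2p2 k 1≤k m = n , h≤n , G , regular , ordered-hamiltonian
  where open Construction m k 1≤k
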